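{- Let $G$ be a connected $\{K_{1,3},2K_1\cup K_3\}$-free graph with independence number at least $4$ which is not isomorphic to any of the graphs $E_1,\dots,E_8$ described in the context. Then $G$ contains neither $C_5$ nor $C_7$ as an induced subgraph.
   Context: All graphs are finite and simple; $\mathcal H$-free means containing no graph of $\mathcal H$ as an induced subgraph. $K_{1,3}$ is the claw, $2K_1\cup K_3$ is the disjoint union of a triangle and two isolated vertices, $C_n$ the cycle on $n$ vertices. Definition of $E_1,\dots,E_8$: Let $H_6$ be the graph obtained from a $5$-cycle $u_1u_2u_3u_4u_5u_1$ by adding three new vertices $w_1,w_2,w_3$, where $w_1$ is adjacent exactly to $u_1,u_2$, $w_2$ exactly to $u_2,u_3$, and $w_3$ exactly to $u_3,u_4$. Consider new vertices $x_A$ with neighbourhood $\{w_1,u_5,u_4\}$ in $H_6$, $x_B$ with neighbourhood $\{u_1,u_2,u_3,u_4,w_1,w_3\}$ in $H_6$, and $x_C$ with neighbourhood $\{w_2,u_5,u_4,u_2,u_3\}$ in $H_6$. Then $E_1=H_6$; $E_2,E_3,E_4$ are $H_6$ plus $x_A$, plus $x_B$, plus $x_C$ respectively; $E_5$ is $H_6$ plus $x_A,x_B$ (non-adjacent); $E_6$ is $H_6$ plus $x_A,x_C$ (adjacent); $E_7$ is $H_6$ plus $x_B,x_C$ (non-adjacent); $E_8$ is $H_6$ plus $x_A,x_B,x_C$ where among these three only $x_Ax_C$ is an edge. -}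

module Defs where

open import Data.Nat using (ℕ; zero; suc; _≡ᵇ_)
open import Data.Bool using (Bool; true; false; _∧_; _∨_; not)
open import Data.Bool.Properties using (∨-comm)
open import Data.Fin using (Fin; toℕ)
open import Data.List using (List; []; _∷_; _++_)
open import Data.Product using (Σ; _×_; _,_; ∃)
open import Relation.Binary.PropositionalEquality using (_≡_; refl; cong; cong₂)
open import Relation.Nullary using (¬_)
open import Function.Definitions using (Injective; Surjective)

record Graph : Set where
  field
    n     : ℕ
    adj   : Fin n → Fin n → Bool
    sym   : ∀ i j → adj i j ≡ adj j i
    irrefl : ∀ i → adj i i ≡ false
open Graph public

V : Graph → Set
V G = Fin (n G)

record InducedEmbedding (H G : Graph) : Set where
  field
    f      : V H → V G
    inj    : Injective _≡_ _≡_ f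
    adjPre : ∀ i j → adj G (f i) (f j) ≡ adj H i j
open InducedEmbedding public

ContainsInduced : Graph → Graph → Set
ContainsInduced G H = InducedEmbedding H G

record Iso (G H : Graph) : Set where
  field
    emb  : InducedEmbedding G H
    surj : Surjective _≡_ _≡_ (f emb)
open Iso public

data Reach (G : Graph) : V G → V G → Set where
  here : ∀ {u} → Reach G u u
  step : ∀ {u v w} → adj G u v ≡ true → Reach G v w → Reach G u w

Connected : Graph → Set
Connected G = ∀ (u v : V G) → Reach G u v

IndependenceAtLeast : ℕ → Graph → Set
IndependenceAtLeast k G =
  Σ (Fin k → V G) λ s → Injective _≡_ _≡_ s × (∀ i j → adj G (s i) (s j) ≡ false)

hasEdge : ℕ → ℕ → List (ℕ × ℕ) → Bool
hasEdge a b [] = false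
hasEdge a b ((x , y) ∷ es) = ((a ≡ᵇ x) ∧ (b ≡ᵇ y)) ∨ hasEdge a b es

≡ᵇ-sym : ∀ a b → (a ≡ᵇ b) ≡ (b ≡ᵇ a)
≡ᵇ-sym zero zero = refl
≡ᵇ-sym zero (suc b) = refl
≡ᵇ-sym (suc a) zero = refl
≡ᵇ-sym (suc a) (suc b) = ≡ᵇ-sym a b

≡ᵇ-refl : ∀ a → (a ≡ᵇ a) ≡ true
≡ᵇ-refl zero = refl
≡ᵇ-refl (suc a) = ≡ᵇ-refl a

fromEdges : (m : ℕ) → List (ℕ × ℕ) → Graph
fromEdges m es = record
  { n = m
  ; adj = A
  ; sym = λ i j → cong₂ _∧_ (cong not (≡ᵇ-sym (toℕ i) (toℕ j)))
                            (∨-comm (hasEdge (toℕ i) (toℕ j) es) (hasEdge (toℕ j) (toℕ i) es))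
  ; irrefl = λ i → cong (λ b → not b ∧ (hasEdge (toℕ i) (toℕ i) es ∨ hasEdge (toℕ i) (toℕ i) es))
                        (≡ᵇ-refl (toℕ i))
  }
  where
  A : Fin m → Fin m → Bool
  A i j = not (toℕ i ≡ᵇ toℕ j) ∧ (hasEdge (toℕ i) (toℕ j) es ∨ hasEdge (toℕ j) (toℕ i) es)

claw : Graph
claw = fromEdges 4 ((0 , 1) ∷ (0 , 2) ∷ (0 , 3) ∷ [])

twoK1∪K3 : Graph
twoK1∪K3 = fromEdges 5 ((0 , 1) ∷ (1 , 2) ∷ (2 , 0) ∷ [])

cycleEdges : ℕ → List (ℕ × ℕ)
cycleEdges m = go m
  where
  go : ℕ → List (ℕ × ℕ)
  go zero = []
  go (suc zero) = (0 , m Data.Nat.∸ 1) ∷ []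
  go (suc (suc k)) = (suc k , k) ∷ go (suc k)

-- C_n for n ≥ 3 (vertices 0..n-1, i ~ i+1, n-1 ~ 0)
C : ℕ → Graph
C m = fromEdges m (cycleEdges m)

-- The graphs E_1, …, E_8.
-- Labels: u1..u5 = 0..4, w1 = 5, w2 = 6, w3 = 7; the added vertices
-- x_A, x_B, x_C receive labels 8, 9, 10 in the order they appear.

H6edges : List (ℕ × ℕ)
H6edges = (0 , 1) ∷ (1 , 2) ∷ (2 , 3) ∷ (3 , 4) ∷ (4 , 0)
        ∷ (5 , 0) ∷ (5 , 1) ∷ (6 , 1) ∷ (6 , 2) ∷ (7 , 2) ∷ (7 , 3) ∷ []

xAedges xBedges xCedges : ℕ → List (ℕ × ℕ)
xAedges x = (x , 5) ∷ (x , 4) ∷ (x , 3) ∷ []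
xBedges x = (x , 0) ∷ (x , 1) ∷ (x , 2) ∷ (x , 3) ∷ (x , 5) ∷ (x , 7) ∷ []
xCedges x = (x , 6) ∷ (x , 4) ∷ (x , 3) ∷ (x , 1) ∷ (x , 2) ∷ []

E1 E2 E3 E4 E5 E6 E7 E8 : Graph
E1 = fromEdges 8 H6edges
E2 = fromEdges 9 (H6edges ++ xAedges 8)
E3 = fromEdges 9 (H6edges ++ xBedges 8)
E4 = fromEdges 9 (H6edges ++ xCedges 8)
E5 = fromEdges 10 (H6edges ++ xAedges 8 ++ xBedges 9)
E6 = fromEdges 10 (H6edges ++ xAedges 8 ++ xCedges 9 ++ (8 , 9) ∷ [])
E7 = fromEdges 10 (H6edges ++ xBedges 8 ++ xCedges 9)
E8 = fromEdges 11 (H6edges ++ xAedges 8 ++ xBedges 9 ++ xCedges 10 ++ (8 , 10) ∷ [])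

module Submission where

-- If G has an induced C₅, every vertex has a neighbour on it: otherwise
-- connectivity gives an edge uw with w far from the cycle, claw- and 2K₁∪K₃-freeness force u to see
-- exactly one edge of the cycle, and four independent vertices cannot be placed around the resulting
-- seven vertices. The neighbourhoods on the cycle of the independent vertices are then so restricted that
-- they span an induced E₁ = H₆. Around H₆ every other vertex has one of five neighbourhood types
-- (x_A, x_B, x_C and mirror images), no type occurs twice and only compatible types coexist, so G is
-- determined by the set of types present and is one of E₁, …, E₈. An induced C₇ has independence
-- number 3, so some vertex off it has a neighbour on it, and any such vertex yields an induced C₅.
--
-- Each finite case analysis is decided by computation: a configuration (a fixed core together with a
-- few vertices given by their neighbourhoods on it) is admissible if its adjacency table shows no claw
-- and no 2K₁∪K₃, and every configuration realised in G is admissible.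

open import Defs
open import Data.Bool using (Bool; true; false; _∧_; _∨_; not; _xor_; if_then_else_; T)
open import Data.Bool.Properties using (∧-conicalˡ; ∧-conicalʳ; T-≡)
open import Data.Empty using (⊥; ⊥-elim)
open import Data.Fin as Fin using (Fin; toℕ)
open import Data.Fin.Patterns using (0F; 1F; 2F; 3F)
open import Data.Fin.Properties using (toℕ-injective; toℕ-fromℕ<; <-cmp)
open import Data.List using (List; []; _∷_; _++_; length; map; concatMap; upTo; allFin; _ʳ++_)
open import Data.Bool.ListAction using (and; all)
open import Data.List.Properties using (length-map)
open import Data.List.Membership.Propositional using (_∈_)
open import Data.List.Membership.Propositional.Properties
  using (∈-++⁺ˡ; ∈-++⁺ʳ; ∈-map⁺; ∈-map⁻; ∈-allFin; ∈-upTo⁺)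
open import Data.List.Relation.Unary.All as All using (All; []; _∷_)
open import Data.List.Relation.Unary.Any using (here; there)
open import Data.List.Relation.Unary.AllPairs using (AllPairs; []; _∷_)
import Data.List.Relation.Unary.AllPairs.Properties as AllPairs
open import Data.List.Relation.Unary.Unique.Propositional using (Unique)
import Data.List.Relation.Unary.Unique.Propositional.Properties as Unique
open import Data.Nat using (ℕ; zero; suc; _+_; _∸_; _<ᵇ_; _≡ᵇ_; _%_; _≤_; z≤n; s≤s)
open import Data.Nat.Properties using (≡ᵇ⇒≡; <ᵇ⇒<; +-identityʳ; +-suc; ∸-cancelʳ-≡; +-cancelˡ-≡; m+[n∸m]≡n)
open import Data.Nat.DivMod using (_mod_; m<n⇒m%n≡m)
open import Data.Product using (Σ; ∃; _×_; _,_; proj₁; proj₂)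
open import Data.Sum using (_⊎_; inj₁; inj₂)
open import Data.Unit using (⊤; tt)
open import Function using (Injective; id; _∘_)
open import Function.Bundles using (Equivalence)
open import Relation.Binary using (tri<; tri≈; tri>)
open import Relation.Binary.PropositionalEquality as ≡ using (_≡_; _≢_; refl; trans; cong; cong₂; subst; subst₂)
open import Relation.Nullary using (¬_; yes; no)

true≢false : true ≢ false
true≢false ()

∨-true : ∀ {a b} → a ∨ b ≡ true → a ≡ true ⊎ b ≡ true
∨-true {true} _ = inj₁ refl
∨-true {false} p = inj₂ p

∨-resolveˡ : ∀ {a b} → a ∨ b ≡ true → a ≡ false → b ≡ true
∨-resolveˡ p refl = p

∧-intro : ∀ {a b} → a ≡ true → b ≡ true → a ∧ b ≡ true
∧-intro refl refl = refl

not-true : ∀ {a} → not a ≡ true → a ≡ false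
not-true {false} _ = refl

not-false : ∀ {a} → a ≡ false → not a ≡ true
not-false refl = refl

≢true⇒≡false : ∀ {a} → a ≢ true → a ≡ false
≢true⇒≡false {true} p = ⊥-elim (p refl)
≢true⇒≡false {false} _ = refl

implies-true : ∀ {a b} → not a ∨ b ≡ true → a ≡ true → b ≡ true
implies-true p refl = p

≡true⇒T : ∀ {a} → a ≡ true → T a
≡true⇒T = Equivalence.from T-≡

_==_ : Bool → Bool → Bool
a == b = not (a xor b)

==⇒≡ : ∀ {a b} → a == b ≡ true → a ≡ b
==⇒≡ {true} {true} _ = refl
==⇒≡ {false} {false} _ = refl

xor⇒≢ : ∀ {a b} → a xor b ≡ true → a ≢ b
xor⇒≢ {true} {true} ()
xor⇒≢ {false} {false} ()

and-All : ∀ bs → and bs ≡ true → All (_≡ true) bs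
and-All [] _ = []
and-All (b ∷ bs) p = ∧-conicalˡ b (and bs) p ∷ and-All bs (∧-conicalʳ b (and bs) p)

≡ᵇ-true⇒≡ : ∀ a b → (a ≡ᵇ b) ≡ true → a ≡ b
≡ᵇ-true⇒≡ a b p = ≡ᵇ⇒≡ a b (≡true⇒T p)

≢⇒≡ᵇ-false : ∀ a b → a ≢ b → (a ≡ᵇ b) ≡ false
≢⇒≡ᵇ-false a b a≢b = ≢true⇒≡false (a≢b ∘ ≡ᵇ-true⇒≡ a b)

<ᵇ-suc : ∀ n → (n <ᵇ suc n) ≡ true
<ᵇ-suc zero = refl
<ᵇ-suc (suc n) = <ᵇ-suc n

<ᵇ-step : ∀ m n → (m <ᵇ n) ≡ true → (m <ᵇ suc n) ≡ true
<ᵇ-step zero n _ = refl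
<ᵇ-step (suc m) (suc n) p = <ᵇ-step m n p

<ᵇ-suc⁻ : ∀ h m → (h <ᵇ suc m) ≡ true → h ≡ m ⊎ (h <ᵇ m) ≡ true
<ᵇ-suc⁻ zero zero _ = inj₁ refl
<ᵇ-suc⁻ zero (suc m) _ = inj₂ refl
<ᵇ-suc⁻ (suc h) (suc m) p with <ᵇ-suc⁻ h m p
... | inj₁ h≡m = inj₁ (cong suc h≡m)
... | inj₂ h<m = inj₂ h<m

<ᵇ-+ʳ : ∀ i m n → (i <ᵇ m) ≡ true → (i <ᵇ m + n) ≡ true
<ᵇ-+ʳ zero (suc m) n _ = refl
<ᵇ-+ʳ (suc i) (suc m) n p = <ᵇ-+ʳ i m n p

∸-<ᵇ : ∀ m j n → (j <ᵇ m) ≡ false → (j <ᵇ m + n) ≡ true → ((j ∸ m) <ᵇ n) ≡ true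
∸-<ᵇ zero j n _ p = p
∸-<ᵇ (suc m) (suc j) n q p = ∸-<ᵇ m j n q p

<ᵇ-false⇒≥ : ∀ a b → (a <ᵇ b) ≡ false → b ≤ a
<ᵇ-false⇒≥ a zero _ = z≤n
<ᵇ-false⇒≥ (suc a) (suc b) p = s≤s (<ᵇ-false⇒≥ a b p)

anyBelowᵇ : ℕ → (ℕ → Bool) → Bool
anyBelowᵇ zero p = false
anyBelowᵇ (suc n) p = p n ∨ anyBelowᵇ n p

anyBelowᵇ-sound : ∀ n p → anyBelowᵇ n p ≡ true → Σ ℕ λ m → (m <ᵇ n) ≡ true × p m ≡ true
anyBelowᵇ-sound (suc n) p h with ∨-true {p n} h
... | inj₁ pn = n , <ᵇ-suc n , pn
... | inj₂ rest with anyBelowᵇ-sound n p rest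
... | m , m<n , pm = m , <ᵇ-step m n m<n , pm

anyBelowᵇ-complete : ∀ n p m → (m <ᵇ n) ≡ true → p m ≡ true → anyBelowᵇ n p ≡ true
anyBelowᵇ-complete (suc n) p m m<n pm with p n in pn
... | true = refl
... | false with <ᵇ-suc⁻ m n m<n
...   | inj₁ refl = ⊥-elim (true≢false (trans (≡.sym pm) pn))
...   | inj₂ m<n′ = anyBelowᵇ-complete n p m m<n′ pm

allBelowᵇ : ℕ → (ℕ → Bool) → Bool
allBelowᵇ zero p = true
allBelowᵇ (suc n) p = p n ∧ allBelowᵇ n p

allBelowᵇ-sound : ∀ n p → allBelowᵇ n p ≡ true → ∀ c → (c <ᵇ n) ≡ true → p c ≡ true
allBelowᵇ-sound (suc n) p h c c<n with <ᵇ-suc⁻ c n c<n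
... | inj₁ refl = ∧-conicalˡ (p n) _ h
... | inj₂ c<n′ = allBelowᵇ-sound n p (∧-conicalʳ (p n) _ h) c c<n′

allBelowᵇ²-sound : ∀ n m (p : ℕ → ℕ → Bool) → allBelowᵇ n (λ a → allBelowᵇ m (p a)) ≡ true →
                   ∀ a b → (a <ᵇ n) ≡ true → (b <ᵇ m) ≡ true → p a b ≡ true
allBelowᵇ²-sound n m p h a b a< b< = allBelowᵇ-sound m (p a) (allBelowᵇ-sound n (λ a → allBelowᵇ m (p a)) h a a<) b b<

allFinᵇ : (n : ℕ) → (Fin n → Bool) → Bool
allFinᵇ zero p = true
allFinᵇ (suc n) p = p Fin.zero ∧ allFinᵇ n (p ∘ Fin.suc)

allFinᵇ-sound : ∀ n p → allFinᵇ n p ≡ true → ∀ i → p i ≡ true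
allFinᵇ-sound (suc n) p h Fin.zero = ∧-conicalˡ (p Fin.zero) _ h
allFinᵇ-sound (suc n) p h (Fin.suc i) = allFinᵇ-sound n (p ∘ Fin.suc) (∧-conicalʳ (p Fin.zero) _ h) i

allFinᵇ²-sound : ∀ n (p : Fin n → Fin n → Bool) → allFinᵇ n (λ a → allFinᵇ n (p a)) ≡ true → ∀ a b → p a b ≡ true
allFinᵇ²-sound n p h a = allFinᵇ-sound n (p a) (allFinᵇ-sound n (λ a → allFinᵇ n (p a)) h a)

anyFinᵇ : (n : ℕ) → (Fin n → Bool) → Bool
anyFinᵇ zero p = false
anyFinᵇ (suc n) p = p Fin.zero ∨ anyFinᵇ n (p ∘ Fin.suc)

anyFinᵇ-sound : ∀ n p → anyFinᵇ n p ≡ true → Σ (Fin n) λ i → p i ≡ true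
anyFinᵇ-sound (suc n) p h with ∨-true {p Fin.zero} h
... | inj₁ p0 = Fin.zero , p0
... | inj₂ rest with anyFinᵇ-sound n (p ∘ Fin.suc) rest
... | i , pi = Fin.suc i , pi

anyFinᵇ-complete : ∀ n p (i : Fin n) → p i ≡ true → anyFinᵇ n p ≡ true
anyFinᵇ-complete (suc n) p Fin.zero pi rewrite pi = refl
anyFinᵇ-complete (suc n) p (Fin.suc i) pi with p Fin.zero
... | true = refl
... | false = anyFinᵇ-complete n (p ∘ Fin.suc) i pi

All⇒all : ∀ {A : Set} (p : A → Bool) {xs} → All (λ x → p x ≡ true) xs → all p xs ≡ true
All⇒all p [] = refl
All⇒all p (px ∷ pxs) = ∧-intro px (All⇒all p pxs)

all-∈ : ∀ {A : Set} (p : A → Bool) (xs : List A) → all p xs ≡ true → ∀ {x} → x ∈ xs → p x ≡ true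
all-∈ p (y ∷ xs) h (here refl) = ∧-conicalˡ (p y) _ h
all-∈ p (y ∷ xs) h (there x∈xs) = all-∈ p xs (∧-conicalʳ (p y) _ h) x∈xs

pairwiseᵇ : ∀ {A : Set} → (A → A → Bool) → List A → Bool
pairwiseᵇ p [] = true
pairwiseᵇ p (x ∷ xs) = all (p x) xs ∧ pairwiseᵇ p xs

pairwiseᵇ-complete : ∀ {A : Set} (p : A → A → Bool) {xs} → AllPairs (λ x y → p x y ≡ true) xs →
                     pairwiseᵇ p xs ≡ true
pairwiseᵇ-complete p [] = refl
pairwiseᵇ-complete p {x ∷ _} (px ∷ pxs) = ∧-intro (All⇒all (p x) px) (pairwiseᵇ-complete p pxs)

allBitListsᵇ : ℕ → (List Bool → Bool) → Bool
allBitListsᵇ zero p = p []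
allBitListsᵇ (suc m) p = allBitListsᵇ m (p ∘ (true ∷_)) ∧ allBitListsᵇ m (p ∘ (false ∷_))

allBitListsᵇ-sound : ∀ m p → allBitListsᵇ m p ≡ true → ∀ bs → length bs ≡ m → p bs ≡ true
allBitListsᵇ-sound zero p h [] refl = h
allBitListsᵇ-sound (suc m) p h (true ∷ bs) refl =
  allBitListsᵇ-sound m (p ∘ (true ∷_)) (∧-conicalˡ (allBitListsᵇ m (p ∘ (true ∷_))) _ h) bs refl
allBitListsᵇ-sound (suc m) p h (false ∷ bs) refl =
  allBitListsᵇ-sound m (p ∘ (false ∷_)) (∧-conicalʳ (allBitListsᵇ m (p ∘ (true ∷_))) _ h) bs refl

lookupOr : {A : Set} → A → List A → ℕ → A
lookupOr d [] _ = d
lookupOr d (x ∷ xs) zero = x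
lookupOr d (x ∷ xs) (suc i) = lookupOr d xs i

lookupOr-∈ : ∀ {A : Set} (d : A) xs i → (i <ᵇ length xs) ≡ true → lookupOr d xs i ∈ xs
lookupOr-∈ d (x ∷ xs) zero _ = here refl
lookupOr-∈ d (x ∷ xs) (suc i) p = there (lookupOr-∈ d xs i p)

lookupOr-map : ∀ {A B : Set} (f : A → B) (d : A) (d′ : B) xs i → (i <ᵇ length xs) ≡ true →
               lookupOr d′ (map f xs) i ≡ f (lookupOr d xs i)
lookupOr-map f d d′ (x ∷ xs) zero _ = refl
lookupOr-map f d d′ (x ∷ xs) (suc i) p = lookupOr-map f d d′ xs i p

lookupOr-injective : ∀ {A : Set} (d : A) xs → Unique xs → ∀ i j → (i <ᵇ length xs) ≡ true →
                     (j <ᵇ length xs) ≡ true → lookupOr d xs i ≡ lookupOr d xs j → i ≡ j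
lookupOr-injective d (x ∷ xs) u zero zero _ _ _ = refl
lookupOr-injective d (x ∷ xs) (x∉ ∷ u) zero (suc j) _ q eq = ⊥-elim (All.lookup x∉ (lookupOr-∈ d xs j q) eq)
lookupOr-injective d (x ∷ xs) (x∉ ∷ u) (suc i) zero p _ eq = ⊥-elim (All.lookup x∉ (lookupOr-∈ d xs i p) (≡.sym eq))
lookupOr-injective d (x ∷ xs) (_ ∷ u) (suc i) (suc j) p q eq = cong suc (lookupOr-injective d xs u i j p q eq)

tabulateFrom : {A : Set} → (ℕ → A) → ℕ → ℕ → List A
tabulateFrom f s zero = []
tabulateFrom f s (suc r) = f s ∷ tabulateFrom f (suc s) r

length-tabulateFrom : ∀ {A : Set} (f : ℕ → A) s r → length (tabulateFrom f s r) ≡ r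
length-tabulateFrom f s zero = refl
length-tabulateFrom f s (suc r) = cong suc (length-tabulateFrom f (suc s) r)

lookupOr-tabulateFrom : ∀ {A : Set} (d : A) f s r j → (j <ᵇ r) ≡ true → lookupOr d (tabulateFrom f s r) j ≡ f (s + j)
lookupOr-tabulateFrom d f s (suc r) zero _ = cong f (≡.sym (+-identityʳ s))
lookupOr-tabulateFrom d f s (suc r) (suc j) p = trans (lookupOr-tabulateFrom d f (suc s) r j p) (cong f (≡.sym (+-suc s j)))

filterᵇ : {A : Set} → (A → Bool) → List A → List A
filterᵇ p [] = []
filterᵇ p (x ∷ xs) = if p x then x ∷ filterᵇ p xs else filterᵇ p xs

_≡ᴮ_ : List Bool → List Bool → Bool
[] ≡ᴮ [] = true
(x ∷ xs) ≡ᴮ (y ∷ ys) = (x == y) ∧ (xs ≡ᴮ ys)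
_ ≡ᴮ _ = false

≡ᴮ⇒≡ : ∀ xs ys → xs ≡ᴮ ys ≡ true → xs ≡ ys
≡ᴮ⇒≡ [] [] _ = refl
≡ᴮ⇒≡ (x ∷ xs) (y ∷ ys) h = cong₂ _∷_ (==⇒≡ (∧-conicalˡ (x == y) _ h)) (≡ᴮ⇒≡ xs ys (∧-conicalʳ (x == y) _ h))

_∈ᴮ_ : List Bool → List (List Bool) → Bool
x ∈ᴮ [] = false
x ∈ᴮ (y ∷ ys) = (x ≡ᴮ y) ∨ (x ∈ᴮ ys)

indexᴮ : List Bool → List (List Bool) → ℕ
indexᴮ x [] = 0
indexᴮ x (y ∷ ys) = if x ≡ᴮ y then 0 else suc (indexᴮ x ys)

∈ᴮ⇒∈ : ∀ x ys → x ∈ᴮ ys ≡ true → x ∈ ys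
∈ᴮ⇒∈ x (y ∷ ys) h with x ≡ᴮ y in eq
... | true = here (≡ᴮ⇒≡ x y eq)
... | false = there (∈ᴮ⇒∈ x ys h)

∈ᴮ⇒indexᴮ : ∀ x ys → x ∈ᴮ ys ≡ true →
            (indexᴮ x ys <ᵇ length ys) ≡ true × x ≡ lookupOr [] ys (indexᴮ x ys)
∈ᴮ⇒indexᴮ x (y ∷ ys) h with x ≡ᴮ y in eq
... | true = refl , ≡ᴮ⇒≡ x y eq
... | false = ∈ᴮ⇒indexᴮ x ys h

upperPairs : (n : ℕ) → List (Fin n × Fin n)
upperPairs zero = []
upperPairs (suc n) = map (λ b → Fin.zero , Fin.suc b) (allFin n) ++ map (λ (a , b) → Fin.suc a , Fin.suc b) (upperPairs n)

upperPairs-complete : ∀ {n} {a b : Fin n} → a Fin.< b → (a , b) ∈ upperPairs n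
upperPairs-complete {suc n} {Fin.zero} {Fin.suc b} _ = ∈-++⁺ˡ (∈-map⁺ _ (∈-allFin b))
upperPairs-complete {suc n} {Fin.suc a} {Fin.suc b} (s≤s a<b) =
  ∈-++⁺ʳ (map _ (allFin n)) (∈-map⁺ _ (upperPairs-complete a<b))

module _ (G : Graph) where

  Preserved : (H : Graph) → (V H → V G) → V H × V H → Set
  Preserved H φ (a , b) = adj G (φ a) (φ b) ≡ adj H a b × φ a ≢ φ b

  embedding-from-upperPairs : (H : Graph) (φ : V H → V G) → All (Preserved H φ) (upperPairs (n H)) → InducedEmbedding H G
  embedding-from-upperPairs H φ ok = record { f = φ ; inj = injective ; adjPre = preserves }
    where
    upper : ∀ {a b} → a Fin.< b → Preserved H φ (a , b)
    upper a<b = All.lookup ok (upperPairs-complete a<b)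
    preserves : ∀ a b → adj G (φ a) (φ b) ≡ adj H a b
    preserves a b with <-cmp a b
    ... | tri< a<b _ _ = proj₁ (upper a<b)
    ... | tri≈ _ refl _ = trans (irrefl G (φ a)) (≡.sym (irrefl H a))
    ... | tri> _ _ b<a = trans (sym G (φ a) (φ b)) (trans (proj₁ (upper b<a)) (sym H b a))
    injective : Injective _≡_ _≡_ φ
    injective {a} {b} eq with <-cmp a b
    ... | tri< a<b _ _ = ⊥-elim (proj₂ (upper a<b) eq)
    ... | tri≈ _ a≡b _ = a≡b
    ... | tri> _ _ b<a = ⊥-elim (proj₂ (upper b<a) (≡.sym eq))

  adjacent⇒≢ : ∀ {u v} → adj G u v ≡ true → u ≢ v
  adjacent⇒≢ {u} uv refl = true≢false (trans (≡.sym uv) (irrefl G u))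

  separatedBy : ∀ {u v} w → adj G u w ≡ true → adj G v w ≡ false → u ≢ v
  separatedBy w uw vw refl = true≢false (trans (≡.sym uw) vw)

  crossing-edge : ∀ {P Q : V G → Set} → (∀ v → P v ⊎ Q v) → (∀ {x} → P x → Q x → ⊥) →
                  ∀ {v t} → Reach G v t → Q v → P t → Σ (V G) λ w → Σ (V G) λ u → adj G w u ≡ true × Q w × P u
  crossing-edge split disjoint here qv pt = ⊥-elim (disjoint pt qv)
  crossing-edge split disjoint (step {v} {v′} vv′ walk) qv pt with split v′
  ... | inj₁ pv′ = v , v′ , vv′ , qv , pv′
  ... | inj₂ qv′ = crossing-edge split disjoint walk qv′ pt

twinFreeᵇ : Graph → Bool
twinFreeᵇ H = allFinᵇ (n H) λ a → allFinᵇ (n H) λ b → (toℕ a ≡ᵇ toℕ b) ∨ anyFinᵇ (n H) (λ l → adj H a l xor adj H b l)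

embedding-of-twinFree : (G H : Graph) → twinFreeᵇ H ≡ true → (φ : V H → V G) →
                        (∀ a b → adj G (φ a) (φ b) ≡ adj H a b) → InducedEmbedding H G
embedding-of-twinFree G H twinFree φ preserves = record { f = φ ; inj = injective ; adjPre = preserves }
  where
  injective : Injective _≡_ _≡_ φ
  injective {a} {b} eq with ∨-true (allFinᵇ-sound (n H) _ (allFinᵇ-sound (n H) _ twinFree a) b)
  ... | inj₁ a≡b = toℕ-injective (≡ᵇ-true⇒≡ (toℕ a) (toℕ b) a≡b)
  ... | inj₂ split with anyFinᵇ-sound (n H) _ split
  ... | l , differ = ⊥-elim (xor⇒≢ differ (trans (≡.sym (preserves a l)) (trans (cong (λ v → adj G v (φ l)) eq) (preserves b l))))

data Candidate : Set where
  clawAt : ℕ → ℕ → ℕ → ℕ → Candidate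
  twoK1∪K3At : ℕ → ℕ → ℕ → ℕ → ℕ → Candidate

module Detection (size : ℕ) (table : ℕ → ℕ → Bool) (knownDistinct : ℕ → ℕ → Bool) where

  inRange : ℕ → Bool
  inRange i = i <ᵇ size

  separated : ℕ → ℕ → Bool
  separated i j = knownDistinct i j ∨ anyBelowᵇ size (λ m → table i m xor table j m)

  conditions : Candidate → List Bool
  conditions (clawAt a b c d) =
    table a b ∷ table a c ∷ table a d ∷ not (table b c) ∷ not (table b d) ∷ not (table c d) ∷
    inRange a ∷ inRange b ∷ inRange c ∷ inRange d ∷ separated b c ∷ separated b d ∷ separated c d ∷ []
  conditions (twoK1∪K3At a b c d e) =
    table a b ∷ table a c ∷ table b c ∷ not (table a d) ∷ not (table b d) ∷ not (table c d) ∷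
    not (table a e) ∷ not (table b e) ∷ not (table c e) ∷ not (table d e) ∷
    inRange a ∷ inRange b ∷ inRange c ∷ inRange d ∷ inRange e ∷ separated d e ∷ []

  detects : Candidate → Bool
  detects c = and (conditions c)

  detectsNone : List Candidate → Bool
  detectsNone = all (not ∘ detects)

record Realisation (G : Graph) : Set where
  field
    size : ℕ
    table : ℕ → ℕ → Bool
    knownDistinct : ℕ → ℕ → Bool
    vertex : ℕ → V G
    table-agrees : ∀ i j → (i <ᵇ size) ≡ true → (j <ᵇ size) ≡ true → table i j ≡ adj G (vertex i) (vertex j)
    knownDistinct-sound : ∀ i j → (i <ᵇ size) ≡ true → (j <ᵇ size) ≡ true → knownDistinct i j ≡ true → vertex i ≢ vertex j

module _ {G : Graph} (clawFree : ¬ ContainsInduced G claw) (twoK1∪K3Free : ¬ ContainsInduced G twoK1∪K3)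
         (R : Realisation G) where
  open Realisation R
  open Detection size table knownDistinct

  private
    at : ∀ {i j} → (i <ᵇ size) ≡ true → (j <ᵇ size) ≡ true → adj G (vertex i) (vertex j) ≡ table i j
    at ri rj = ≡.sym (table-agrees _ _ ri rj)

    atᵀ : ∀ {i j} → (i <ᵇ size) ≡ true → (j <ᵇ size) ≡ true → adj G (vertex j) (vertex i) ≡ table i j
    atᵀ ri rj = trans (sym G _ _) (at ri rj)

    edge : ∀ {i j} → (i <ᵇ size) ≡ true → (j <ᵇ size) ≡ true → table i j ≡ true →
           adj G (vertex i) (vertex j) ≡ true × vertex i ≢ vertex j
    edge ri rj t = trans (at ri rj) t , adjacent⇒≢ G (trans (at ri rj) t)

    nonEdge : ∀ {i j} → (i <ᵇ size) ≡ true → (j <ᵇ size) ≡ true → not (table i j) ≡ true → vertex i ≢ vertex j →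
              adj G (vertex i) (vertex j) ≡ false × vertex i ≢ vertex j
    nonEdge ri rj t i≢j = trans (at ri rj) (not-true t) , i≢j

    separated-sound : ∀ {i j} → (i <ᵇ size) ≡ true → (j <ᵇ size) ≡ true → separated i j ≡ true → vertex i ≢ vertex j
    separated-sound {i} {j} ri rj s eq with ∨-true {knownDistinct i j} s
    ... | inj₁ d = knownDistinct-sound i j ri rj d eq
    ... | inj₂ split with anyBelowᵇ-sound size _ split
    ... | m , rm , differ = xor⇒≢ differ (trans (≡.sym (at ri rm)) (trans (cong (λ v → adj G v (vertex m)) eq) (at rj rm)))

    claw-undetected : ∀ a b c d → detects (clawAt a b c d) ≡ true → ⊥
    claw-undetected a b c d h with and-All (conditions (clawAt a b c d)) h
    ... | ab ∷ ac ∷ ad ∷ bc ∷ bd ∷ cd ∷ ra ∷ rb ∷ rc ∷ rd ∷ sbc ∷ sbd ∷ scd ∷ [] =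
      clawFree (embedding-from-upperPairs G claw φ
        ( edge ra rb ab ∷ edge ra rc ac ∷ edge ra rd ad
        ∷ nonEdge rb rc bc (separated-sound rb rc sbc) ∷ nonEdge rb rd bd (separated-sound rb rd sbd)
        ∷ nonEdge rc rd cd (separated-sound rc rd scd) ∷ []))
      where
      φ : Fin 4 → V G
      φ Fin.zero = vertex a
      φ (Fin.suc Fin.zero) = vertex b
      φ (Fin.suc (Fin.suc Fin.zero)) = vertex c
      φ (Fin.suc (Fin.suc (Fin.suc Fin.zero))) = vertex d

    twoK1∪K3-undetected : ∀ a b c d e → detects (twoK1∪K3At a b c d e) ≡ true → ⊥
    twoK1∪K3-undetected a b c d e h with and-All (conditions (twoK1∪K3At a b c d e)) h
    ... | ab ∷ ac ∷ bc ∷ ad ∷ bd ∷ cd ∷ ae ∷ be ∷ ce ∷ de ∷ ra ∷ rb ∷ rc ∷ rd ∷ re ∷ sde ∷ [] =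
      twoK1∪K3Free (embedding-from-upperPairs G twoK1∪K3 φ
        ( edge ra rb ab ∷ edge ra rc ac
        ∷ nonEdge ra rd ad (separatedBy G (vertex b) (trans (at ra rb) ab) (trans (atᵀ rb rd) (not-true bd)))
        ∷ nonEdge ra re ae (separatedBy G (vertex b) (trans (at ra rb) ab) (trans (atᵀ rb re) (not-true be)))
        ∷ edge rb rc bc
        ∷ nonEdge rb rd bd (separatedBy G (vertex c) (trans (at rb rc) bc) (trans (atᵀ rc rd) (not-true cd)))
        ∷ nonEdge rb re be (separatedBy G (vertex c) (trans (at rb rc) bc) (trans (atᵀ rc re) (not-true ce)))
        ∷ nonEdge rc rd cd (separatedBy G (vertex a) (trans (atᵀ ra rc) ac) (trans (atᵀ ra rd) (not-true ad)))
        ∷ nonEdge rc re ce (separatedBy G (vertex a) (trans (atᵀ ra rc) ac) (trans (atᵀ ra re) (not-true ae)))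
        ∷ nonEdge rd re de (separated-sound rd re sde) ∷ []))
      where
      φ : Fin 5 → V G
      φ Fin.zero = vertex a
      φ (Fin.suc Fin.zero) = vertex b
      φ (Fin.suc (Fin.suc Fin.zero)) = vertex c
      φ (Fin.suc (Fin.suc (Fin.suc Fin.zero))) = vertex d
      φ (Fin.suc (Fin.suc (Fin.suc (Fin.suc Fin.zero)))) = vertex e

    undetected : ∀ c → detects c ≡ false
    undetected c with detects c in h
    ... | false = refl
    undetected (clawAt a b c d) | true = ⊥-elim (claw-undetected a b c d h)
    undetected (twoK1∪K3At a b c d e) | true = ⊥-elim (twoK1∪K3-undetected a b c d e h)

  realisation-detectsNone : ∀ cs → detectsNone cs ≡ true
  realisation-detectsNone cs = All⇒all (not ∘ detects) (All.universal (not-false ∘ undetected) cs)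

-- Indices below m are core vertices; index m + p is the p-th further vertex, whose adjacency to the
-- core is read off its profile in news and to the other further vertices off nn.
extendedTable : ℕ → (ℕ → ℕ → Bool) → List (List Bool) → (ℕ → ℕ → Bool) → ℕ → ℕ → Bool
extendedTable m H news nn i j =
  if i <ᵇ m then (if j <ᵇ m then H i j else lookupOr false (lookupOr [] news (j ∸ m)) i)
  else (if j <ᵇ m then lookupOr false (lookupOr [] news (i ∸ m)) j else nn (i ∸ m) (j ∸ m))

memoise : ℕ → (ℕ → ℕ → Bool) → List (List Bool)
memoise k f = tabulateFrom (λ i → tabulateFrom (f i) 0 k) 0 k

entry : List (List Bool) → ℕ → ℕ → Bool
entry M i j = lookupOr false (lookupOr [] M i) j

entry-memoise : ∀ k f i j → (i <ᵇ k) ≡ true → (j <ᵇ k) ≡ true → entry (memoise k f) i j ≡ f i j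
entry-memoise k f i j ri rj =
  trans (cong (λ row → lookupOr false row j) (lookupOr-tabulateFrom [] _ 0 k i ri)) (lookupOr-tabulateFrom false (f i) 0 k j rj)

truePositionsFrom : List Bool → ℕ → List ℕ
truePositionsFrom [] s = []
truePositionsFrom (true ∷ bs) s = s ∷ truePositionsFrom bs (suc s)
truePositionsFrom (false ∷ bs) s = truePositionsFrom bs (suc s)

module Candidates (k : ℕ) (M : List (List Bool)) (relevant : ℕ → Bool) where

  private
    adjacent : ℕ → ℕ → Bool
    adjacent = entry M

    neighbours : ℕ → List ℕ
    neighbours a = truePositionsFrom (lookupOr [] M a) 0

    after : ℕ → List ℕ → List ℕ
    after c [] = []
    after c (x ∷ xs) = if x ≡ᵇ c then xs else after c xs

    clawsAt : ℕ → List ℕ → List Candidate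
    clawsAt a [] = []
    clawsAt a (b ∷ bs) =
      concatMap (λ c → if adjacent b c then [] else
        concatMap (λ d → if adjacent b d ∨ adjacent c d then [] else
          (if relevant a ∨ relevant b ∨ relevant c ∨ relevant d then clawAt a b c d ∷ [] else [])) (after c bs)) bs
      ++ clawsAt a bs

    nonAdjacentPairs : List ℕ → List (ℕ × ℕ)
    nonAdjacentPairs [] = []
    nonAdjacentPairs (d ∷ ds) = concatMap (λ e → if adjacent d e then [] else (d , e) ∷ []) ds ++ nonAdjacentPairs ds

    trianglesAt : ℕ → List ℕ → List Candidate
    trianglesAt a [] = []
    trianglesAt a (b ∷ bs) =
      concatMap (λ c → if adjacent b c then
        concatMap (λ (d , e) → if relevant a ∨ relevant b ∨ relevant c ∨ relevant d ∨ relevant e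
                                then twoK1∪K3At a b c d e ∷ [] else [])
                  (nonAdjacentPairs (filterᵇ (λ x → not (adjacent a x ∨ adjacent b x ∨ adjacent c x)) (upTo k)))
        else []) bs
      ++ trianglesAt a bs

  candidates : List Candidate
  candidates = concatMap (λ a → clawsAt a (neighbours a)) (upTo k)
            ++ concatMap (λ a → trianglesAt a (filterᵇ (a <ᵇ_) (neighbours a))) (upTo k)

distinctOffCore : ℕ → ℕ → ℕ → Bool
distinctOffCore m i j = not (i ≡ᵇ j) ∧ (not (i <ᵇ m) ∨ not (j <ᵇ m))

-- Only candidates touching a relevant index are examined: this prunes the search, and soundness
-- holds for every choice of relevant.
opaque
  admissible : ℕ → (ℕ → ℕ → Bool) → List (List Bool) → (ℕ → ℕ → Bool) → (ℕ → Bool) → Bool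
  admissible m H news nn relevant =
    Detection.detectsNone k (entry M) (distinctOffCore m) (Candidates.candidates k M relevant)
    where
    k : ℕ
    k = m + length news
    M : List (List Bool)
    M = memoise k (extendedTable m H news nn)

record Core (G : Graph) : Set where
  field
    coreSize : ℕ
    coreAdj : ℕ → ℕ → Bool
    coreVertex : ℕ → V G
    coreAdj-agrees : ∀ i j → coreAdj i j ≡ adj G (coreVertex i) (coreVertex j)
open Core

profile : ∀ {G} → Core G → V G → List Bool
profile {G} K v = tabulateFrom (λ h → adj G v (coreVertex K h)) 0 (coreSize K)

profile-at : ∀ {G} (K : Core G) v h → (h <ᵇ coreSize K) ≡ true → lookupOr false (profile K v) h ≡ adj G v (coreVertex K h)
profile-at {G} K v h = lookupOr-tabulateFrom false (λ h → adj G v (coreVertex K h)) 0 (coreSize K) h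

length-profile : ∀ {G} (K : Core G) v → length (profile K v) ≡ coreSize K
length-profile {G} K v = length-tabulateFrom (λ h → adj G v (coreVertex K h)) 0 (coreSize K)

OutsideCore : ∀ {G} → Core G → V G → Set
OutsideCore K v = ∀ h → (h <ᵇ coreSize K) ≡ true → coreVertex K h ≢ v

module Extension {G : Graph} (K : Core G) (xs : List (V G)) (nn : ℕ → ℕ → Bool)
  (nn-agrees : ∀ x y → (x <ᵇ length xs) ≡ true → (y <ᵇ length xs) ≡ true →
               nn x y ≡ adj G (lookupOr (coreVertex K 0) xs x) (lookupOr (coreVertex K 0) xs y))
  (outside : All (OutsideCore K) xs) (unique : Unique xs) where

  private
    m : ℕ
    m = coreSize K
    extra : ℕ → V G
    extra = lookupOr (coreVertex K 0) xs

  news : List (List Bool)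
  news = map (profile K) xs

  size : ℕ
  size = m + length news

  vertex : ℕ → V G
  vertex i = if i <ᵇ m then coreVertex K i else extra (i ∸ m)

  private
    T₀ : ℕ → ℕ → Bool
    T₀ = extendedTable m (coreAdj K) news nn

    extra-index : ∀ i → (i <ᵇ m) ≡ false → (i <ᵇ size) ≡ true → ((i ∸ m) <ᵇ length xs) ≡ true
    extra-index i i≥m i<k = subst (λ l → ((i ∸ m) <ᵇ l) ≡ true) (length-map (profile K) xs) (∸-<ᵇ m i (length news) i≥m i<k)

    news-at : ∀ p h → (p <ᵇ length xs) ≡ true → (h <ᵇ m) ≡ true →
              lookupOr false (lookupOr [] news p) h ≡ adj G (extra p) (coreVertex K h)
    news-at p h p< h< rewrite lookupOr-map (profile K) (coreVertex K 0) [] xs p p< = profile-at K (extra p) h h<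

    T₀-agrees : ∀ i j → (i <ᵇ size) ≡ true → (j <ᵇ size) ≡ true → T₀ i j ≡ adj G (vertex i) (vertex j)
    T₀-agrees i j ri rj with i <ᵇ m in ei | j <ᵇ m in ej
    ... | true | true = coreAdj-agrees K i j
    ... | true | false = trans (news-at (j ∸ m) i (extra-index j ej rj) ei) (sym G _ _)
    ... | false | true = news-at (i ∸ m) j (extra-index i ei ri) ej
    ... | false | false = nn-agrees (i ∸ m) (j ∸ m) (extra-index i ei ri) (extra-index j ej rj)

    extra-outside : ∀ p h → (p <ᵇ length xs) ≡ true → (h <ᵇ m) ≡ true → coreVertex K h ≢ extra p
    extra-outside p h p< = All.lookup outside (lookupOr-∈ (coreVertex K 0) xs p p<) h

    distinctOffCore-sound : ∀ i j → (i <ᵇ size) ≡ true → (j <ᵇ size) ≡ true → distinctOffCore m i j ≡ true →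
                            vertex i ≢ vertex j
    distinctOffCore-sound i j ri rj d with i <ᵇ m in ei | j <ᵇ m in ej
    ... | true | true = λ _ → true≢false (≡.sym (∧-conicalʳ (not (i ≡ᵇ j)) _ d))
    ... | true | false = extra-outside (j ∸ m) i (extra-index j ej rj) ei
    ... | false | true = extra-outside (i ∸ m) j (extra-index i ei ri) ej ∘ ≡.sym
    ... | false | false = i≢j ∘ ∸-cancelʳ-≡ (<ᵇ-false⇒≥ i m ei) (<ᵇ-false⇒≥ j m ej)
                              ∘ lookupOr-injective (coreVertex K 0) xs unique _ _ (extra-index i ei ri) (extra-index j ej rj)
      where
      i≢j : i ≢ j
      i≢j refl = true≢false (≡.sym (trans (cong not (≡.sym (≡ᵇ-refl i))) (∧-conicalˡ (not (i ≡ᵇ i)) _ d)))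

  realisation : Realisation G
  realisation = record
    { size = size
    ; table = entry (memoise size T₀)
    ; knownDistinct = distinctOffCore m
    ; vertex = vertex
    ; table-agrees = λ i j ri rj → trans (entry-memoise size T₀ i j ri rj) (T₀-agrees i j ri rj)
    ; knownDistinct-sound = distinctOffCore-sound
    }

  opaque
    unfolding admissible

    admissible-realised : ¬ ContainsInduced G claw → ¬ ContainsInduced G twoK1∪K3 →
                          ∀ relevant → admissible m (coreAdj K) news nn relevant ≡ true
    admissible-realised clawFree twoK1∪K3Free relevant =
      realisation-detectsNone clawFree twoK1∪K3Free realisation (Candidates.candidates size (memoise size T₀) relevant)

noEdges : ℕ → ℕ → Bool
noEdges _ _ = false

isNew : ℕ → ℕ → Bool
isNew m x = not (x <ᵇ m)

InCore : ∀ {G} → Core G → V G → Set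
InCore K v = Σ ℕ λ h → (h <ᵇ coreSize K) ≡ true × coreVertex K h ≡ v

locateBelow : ∀ {k} m (e : ℕ → Fin k) v →
              (Σ ℕ λ h → (h <ᵇ m) ≡ true × e h ≡ v) ⊎ (∀ h → (h <ᵇ m) ≡ true → e h ≢ v)
locateBelow zero e v = inj₂ (λ _ ())
locateBelow (suc m) e v with e m Fin.≟ v
... | yes em≡v = inj₁ (m , <ᵇ-suc m , em≡v)
... | no em≢v with locateBelow m e v
...   | inj₁ (h , h<m , eh≡v) = inj₁ (h , <ᵇ-step h m h<m , eh≡v)
...   | inj₂ missing = inj₂ λ h h<sm → absent h (<ᵇ-suc⁻ h m h<sm)
  where
  absent : ∀ h → h ≡ m ⊎ (h <ᵇ m) ≡ true → e h ≢ v
  absent h (inj₁ refl) = em≢v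
  absent h (inj₂ h<m) = missing h h<m

locate : ∀ {G} (K : Core G) v → InCore K v ⊎ OutsideCore K v
locate K = locateBelow (coreSize K) (coreVertex K)

inside-or-outside : ∀ {G k} (K : Core G) (g : Fin k → V G) → (∀ i → InCore K (g i)) ⊎ Σ (Fin k) λ i → OutsideCore K (g i)
inside-or-outside {k = zero} K g = inj₁ λ ()
inside-or-outside {k = suc k} K g with locate K (g Fin.zero) | inside-or-outside K (g ∘ Fin.suc)
... | inj₂ outside | _ = inj₂ (Fin.zero , outside)
... | inj₁ _ | inj₂ (i , outside) = inj₂ (Fin.suc i , outside)
... | inj₁ inside₀ | inj₁ inside = inj₁ λ { Fin.zero → inside₀ ; (Fin.suc i) → inside i }

module Single {G : Graph} (K : Core G) (v : V G) (v-outside : OutsideCore K v) where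

  private
    noEdges-agrees : ∀ x y → (x <ᵇ 1) ≡ true → (y <ᵇ 1) ≡ true →
                     noEdges x y ≡ adj G (lookupOr (coreVertex K 0) (v ∷ []) x) (lookupOr (coreVertex K 0) (v ∷ []) y)
    noEdges-agrees zero zero _ _ = ≡.sym (irrefl G v)

    v-outsides : All (OutsideCore K) (v ∷ [])
    v-outsides = v-outside ∷ []

    v-unique : Unique (v ∷ [])
    v-unique = [] ∷ []

  open Extension K (v ∷ []) noEdges noEdges-agrees v-outsides v-unique public

profilesWithinᵇ : ℕ → (ℕ → ℕ → Bool) → (List Bool → Bool) → List (List Bool) → Bool
profilesWithinᵇ m H excluded allowed =
  allBitListsᵇ m (λ bs → not (admissible m H (bs ∷ []) noEdges (isNew m)) ∨ excluded bs ∨ (bs ∈ᴮ allowed))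

module _ {G : Graph} (clawFree : ¬ ContainsInduced G claw) (twoK1∪K3Free : ¬ ContainsInduced G twoK1∪K3) where

  profile-within : ∀ (K : Core G) v → OutsideCore K v → ∀ excluded allowed →
                   profilesWithinᵇ (coreSize K) (coreAdj K) excluded allowed ≡ true →
                   excluded (profile K v) ≡ false → profile K v ∈ᴮ allowed ≡ true
  profile-within K v v-outside excluded allowed certificate not-excluded =
    ∨-resolveˡ (implies-true (allBitListsᵇ-sound (coreSize K) _ certificate (profile K v) (length-profile K v))
                             (Single.admissible-realised K v v-outside clawFree twoK1∪K3Free (isNew (coreSize K))))
               not-excluded

data Position : Set where
  atCore : ℕ → Position
  offCore : List Bool → Position

offCoreProfiles : List Position → List (List Bool)
offCoreProfiles [] = []
offCoreProfiles (atCore _ ∷ ps) = offCoreProfiles ps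
offCoreProfiles (offCore b ∷ ps) = b ∷ offCoreProfiles ps

positions : ℕ → List (List Bool) → List Position
positions m allowed = map atCore (upTo m) ++ map offCore allowed

module IndependentSearch (m : ℕ) (H : ℕ → ℕ → Bool) (conclusion : List Position → Bool) where

  compatible : Position → Position → Bool
  compatible (atCore h) (atCore h′) = not (h ≡ᵇ h′) ∧ not (H h h′)
  compatible (atCore h) (offCore b) = not (lookupOr false b h)
  compatible (offCore b) (atCore h) = not (lookupOr false b h)
  compatible (offCore _) (offCore _) = true

  -- Each new off-core vertex only needs to be checked against candidates containing it (index m);
  -- the earlier ones were checked when they were added.
  extends : List Position → Position → Bool
  extends pre (atCore h) = all (λ p → compatible p (atCore h)) pre
  extends pre (offCore b) = all (λ p → compatible p (offCore b)) pre ∧ admissible m H (b ∷ offCoreProfiles pre) noEdges (_≡ᵇ m)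

  search : ℕ → List Position → List Position → Bool
  search zero U pre = conclusion pre
  search (suc d) U pre = all (λ u → not (extends pre u) ∨ search d U (u ∷ pre)) U

  Extends : List Position → List Position → Set
  Extends pre [] = ⊤
  Extends pre (u ∷ q) = extends pre u ≡ true × Extends (u ∷ pre) q

  search-sound : ∀ d U pre → search d U pre ≡ true → ∀ q → length q ≡ d → (∀ {u} → u ∈ q → u ∈ U) →
                 Extends pre q → conclusion (q ʳ++ pre) ≡ true
  search-sound zero U pre h [] refl _ _ = h
  search-sound (suc d) U pre h (u ∷ q) refl q⊆U (u-extends , rest) =
    search-sound d U (u ∷ pre) (implies-true (all-∈ _ U h (q⊆U (here refl))) u-extends) q refl (q⊆U ∘ there) rest

opaque
  everyIndependentQuadrupleᵇ : ℕ → (ℕ → ℕ → Bool) → (List Position → Bool) → List Position → Bool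
  everyIndependentQuadrupleᵇ m H conclusion U = IndependentSearch.search m H conclusion 4 U []

module IndependentSet {G : Graph} (clawFree : ¬ ContainsInduced G claw) (twoK1∪K3Free : ¬ ContainsInduced G twoK1∪K3)
  (K : Core G) (ss : List (V G)) (independent : ∀ {v w} → v ∈ ss → w ∈ ss → adj G v w ≡ false)
  (allowed : List (List Bool)) (allowed-profiles : ∀ v → v ∈ ss → OutsideCore K v → profile K v ∈ allowed)
  (conclusion : List Position → Bool) where

  open IndependentSearch (coreSize K) (coreAdj K) conclusion

  private
    m : ℕ
    m = coreSize K

  positionOf : V G → Position
  positionOf v with locate K v
  ... | inj₁ (h , _) = atCore h
  ... | inj₂ _ = offCore (profile K v)

  offCoreVertices : List (V G) → List (V G)
  offCoreVertices [] = []
  offCoreVertices (v ∷ vs) with locate K v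
  ... | inj₁ _ = offCoreVertices vs
  ... | inj₂ _ = v ∷ offCoreVertices vs

  offCoreProfiles-positionOf : ∀ vs → offCoreProfiles (map positionOf vs) ≡ map (profile K) (offCoreVertices vs)
  offCoreProfiles-positionOf [] = refl
  offCoreProfiles-positionOf (v ∷ vs) with locate K v
  ... | inj₁ _ = offCoreProfiles-positionOf vs
  ... | inj₂ _ = cong (profile K v ∷_) (offCoreProfiles-positionOf vs)

  offCoreVertices-⊆ : ∀ vs {x} → x ∈ offCoreVertices vs → x ∈ vs
  offCoreVertices-⊆ (v ∷ vs) x∈ with locate K v
  ... | inj₁ _ = there (offCoreVertices-⊆ vs x∈)
  offCoreVertices-⊆ (v ∷ vs) (here x≡v) | inj₂ _ = here x≡v
  offCoreVertices-⊆ (v ∷ vs) (there x∈) | inj₂ _ = there (offCoreVertices-⊆ vs x∈)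

  offCoreVertices-outside : ∀ vs → All (OutsideCore K) (offCoreVertices vs)
  offCoreVertices-outside [] = []
  offCoreVertices-outside (v ∷ vs) with locate K v
  ... | inj₁ _ = offCoreVertices-outside vs
  ... | inj₂ v-outside = v-outside ∷ offCoreVertices-outside vs

  All-offCoreVertices : ∀ {P : V G → Set} vs → All P vs → All P (offCoreVertices vs)
  All-offCoreVertices [] [] = []
  All-offCoreVertices (v ∷ vs) (pv ∷ pvs) with locate K v
  ... | inj₁ _ = All-offCoreVertices vs pvs
  ... | inj₂ _ = pv ∷ All-offCoreVertices vs pvs

  Unique-offCoreVertices : ∀ vs → Unique vs → Unique (offCoreVertices vs)
  Unique-offCoreVertices [] [] = []
  Unique-offCoreVertices (v ∷ vs) (v∉ ∷ u) with locate K v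
  ... | inj₁ _ = Unique-offCoreVertices vs u
  ... | inj₂ _ = All-offCoreVertices vs v∉ ∷ Unique-offCoreVertices vs u

  independent-agrees : ∀ (vs : List (V G)) → (∀ {x} → x ∈ vs → x ∈ ss) →
                       ∀ x y → (x <ᵇ length vs) ≡ true → (y <ᵇ length vs) ≡ true →
                       noEdges x y ≡ adj G (lookupOr (coreVertex K 0) vs x) (lookupOr (coreVertex K 0) vs y)
  independent-agrees vs vs⊆ss x y x< y< = ≡.sym (independent (vs⊆ss (lookupOr-∈ _ vs x x<)) (vs⊆ss (lookupOr-∈ _ vs y y<)))

  private
    compatible-positions : ∀ p s → p ∈ ss → s ∈ ss → p ≢ s → compatible (positionOf p) (positionOf s) ≡ true
    compatible-positions p s p∈ s∈ p≢s with locate K p | locate K s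
    ... | inj₁ (h , _ , ep) | inj₁ (h′ , _ , es) with h ≡ᵇ h′ in eq
    ...   | true = ⊥-elim (p≢s (trans (≡.sym ep) (trans (cong (coreVertex K) (≡ᵇ-true⇒≡ h h′ eq)) es)))
    ...   | false rewrite coreAdj-agrees K h h′ | ep | es | independent p∈ s∈ = refl
    compatible-positions p s p∈ s∈ p≢s | inj₁ (h , h< , ep) | inj₂ _ rewrite profile-at K s h h< | ep | independent s∈ p∈ = refl
    compatible-positions p s p∈ s∈ p≢s | inj₂ _ | inj₁ (h , h< , es) rewrite profile-at K p h h< | es | independent p∈ s∈ = refl
    compatible-positions p s p∈ s∈ p≢s | inj₂ _ | inj₂ _ = refl

    compatible-all : ∀ pre s → s ∈ ss → All (_∈ ss) pre → All (_≢ s) pre →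
                     all (λ c → compatible c (positionOf s)) (map positionOf pre) ≡ true
    compatible-all [] s _ _ _ = refl
    compatible-all (p ∷ pre) s s∈ (p∈ ∷ pre⊆) (p≢s ∷ pre≢s)
      rewrite compatible-positions p s p∈ s∈ p≢s = compatible-all pre s s∈ pre⊆ pre≢s

    extends-positions : ∀ pre s → s ∈ ss → All (_∈ ss) pre → All (_≢ s) pre → Unique pre →
                        extends (map positionOf pre) (positionOf s) ≡ true
    extends-positions pre s s∈ pre⊆ pre≢s u with locate K s | compatible-all pre s s∈ pre⊆ pre≢s
    ... | inj₁ _ | compat = compat
    ... | inj₂ s-outside | compat rewrite compat | offCoreProfiles-positionOf pre =
      Extension.admissible-realised K vs noEdges (independent-agrees vs vs⊆ss) outsides unique clawFree twoK1∪K3Free (_≡ᵇ m)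
      where
      vs : List (V G)
      vs = s ∷ offCoreVertices pre
      vs⊆ss : ∀ {x} → x ∈ vs → x ∈ ss
      vs⊆ss (here refl) = s∈
      vs⊆ss (there x∈) = All.lookup pre⊆ (offCoreVertices-⊆ pre x∈)
      outsides : All (OutsideCore K) vs
      outsides = s-outside ∷ offCoreVertices-outside pre
      unique : Unique vs
      unique = All-offCoreVertices pre (All.map (_∘ ≡.sym) pre≢s) ∷ Unique-offCoreVertices pre u

    extends-all : ∀ pre post → Unique post → All (λ p → All (p ≢_) post) pre → All (_∈ ss) pre → All (_∈ ss) post →
                  Unique pre → Extends (map positionOf pre) (map positionOf post)
    extends-all pre [] _ _ _ _ _ = tt
    extends-all pre (s ∷ post) (s∉ ∷ u-post) cross pre⊆ (s∈ ∷ post⊆) u-pre =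
      extends-positions pre s s∈ pre⊆ (All.map All.head cross) u-pre ,
      extends-all (s ∷ pre) post u-post (s∉ ∷ All.map All.tail cross) (s∈ ∷ pre⊆) post⊆
                  (All.map (λ p≢ eq → All.head p≢ (≡.sym eq)) cross ∷ u-pre)

    position-∈ : ∀ s → s ∈ ss → positionOf s ∈ positions m allowed
    position-∈ s s∈ with locate K s
    ... | inj₁ (h , h< , _) = ∈-++⁺ˡ (∈-map⁺ atCore (∈-upTo⁺ (<ᵇ⇒< h m (≡true⇒T h<))))
    ... | inj₂ s-outside = ∈-++⁺ʳ (map atCore (upTo m)) (∈-map⁺ offCore (allowed-profiles s s∈ s-outside))

  opaque
    unfolding everyIndependentQuadrupleᵇ

    conclusion-holds : everyIndependentQuadrupleᵇ m (coreAdj K) conclusion (positions m allowed) ≡ true →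
                       Unique ss → length ss ≡ 4 → conclusion (map positionOf ss ʳ++ []) ≡ true
    conclusion-holds h u len =
      search-sound 4 (positions m allowed) [] h (map positionOf ss) (trans (length-map positionOf ss) len) in-positions
                   (extends-all [] ss u [] [] (All.tabulate id) [])
      where
      in-positions : ∀ {p} → p ∈ map positionOf ss → p ∈ positions m allowed
      in-positions p∈ with ∈-map⁻ positionOf p∈
      ... | x , x∈ , refl = position-∈ x x∈

matchesᵇ : ℕ → (ℕ → ℕ → Bool) → (H : Graph) → (V H → ℕ) → Bool
matchesᵇ size table H idx =
  allFinᵇ (n H) (λ a → idx a <ᵇ size) ∧ allFinᵇ (n H) (λ a → allFinᵇ (n H) (λ b → table (idx a) (idx b) == adj H a b))

embedding-of-match : ∀ {G} (R : Realisation G) (H : Graph) (idx : V H → ℕ) →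
                     matchesᵇ (Realisation.size R) (Realisation.table R) H idx ≡ true → twinFreeᵇ H ≡ true → InducedEmbedding H G
embedding-of-match {G} R H idx match twinFree = embedding-of-twinFree G H twinFree (Realisation.vertex R ∘ idx) preserves
  where
  in-range : ∀ a → (idx a <ᵇ Realisation.size R) ≡ true
  in-range = allFinᵇ-sound (n H) _ (∧-conicalˡ _ _ match)
  preserves : ∀ a b → adj G (Realisation.vertex R (idx a)) (Realisation.vertex R (idx b)) ≡ adj H a b
  preserves a b = trans (≡.sym (Realisation.table-agrees R _ _ (in-range a) (in-range b)))
                        (==⇒≡ (allFinᵇ-sound (n H) _ (allFinᵇ-sound (n H) _ (∧-conicalʳ _ _ match) a) b))

-- Around an induced C₅

toFin : (k : ℕ) → ℕ → Fin (suc k)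
toFin k i = i mod suc k

emptyOnᵇ : ℕ → List Bool → Bool
emptyOnᵇ m bs = not (anyBelowᵇ m (lookupOr false bs))

adjC5 : ℕ → ℕ → Bool
adjC5 i j = adj (C 5) (toFin 4 i) (toFin 4 j)

noNeighbours₅ : List Bool
noNeighbours₅ = false ∷ false ∷ false ∷ false ∷ false ∷ []

edgeProfiles : List (List Bool)
edgeProfiles =
  (true ∷ true ∷ false ∷ false ∷ false ∷ []) ∷
  (false ∷ true ∷ true ∷ false ∷ false ∷ []) ∷
  (false ∷ false ∷ true ∷ true ∷ false ∷ []) ∷
  (false ∷ false ∷ false ∷ true ∷ true ∷ []) ∷
  (true ∷ false ∷ false ∷ false ∷ true ∷ []) ∷ []

edgeProfile : ℕ → List Bool
edgeProfile r = lookupOr [] edgeProfiles r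

adjacentPair : ℕ → ℕ → Bool
adjacentPair x y = not (x ≡ᵇ y)

neighbourOfFarᵇ : List Bool → Bool
neighbourOfFarᵇ bs =
  not (admissible 5 adjC5 (bs ∷ noNeighbours₅ ∷ []) adjacentPair (isNew 5)) ∨ emptyOnᵇ 5 bs ∨ (bs ∈ᴮ edgeProfiles)

opaque
  unfolding admissible

  neighbour-of-far-profiles : allBitListsᵇ 5 neighbourOfFarᵇ ≡ true
  neighbour-of-far-profiles = refl

-- The cycle on indices 0–4, a vertex 5 adjacent exactly to the edge r(r+1), and a pendant vertex 6 at 5.
adjC5WithPendant : ℕ → ℕ → ℕ → Bool
adjC5WithPendant r i j =
  if i <ᵇ 5 then (if j <ᵇ 5 then adjC5 i j else (if j ≡ᵇ 5 then lookupOr false (edgeProfile r) i else false))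
  else if i ≡ᵇ 5 then (if j <ᵇ 5 then lookupOr false (edgeProfile r) j else not (j ≡ᵇ 5))
  else (if j <ᵇ 5 then false else j ≡ᵇ 5)

pendantProfiles0 : List (List Bool)
pendantProfiles0 =
  (true ∷ true ∷ true ∷ true ∷ true ∷ false ∷ false ∷ []) ∷
  (false ∷ true ∷ true ∷ false ∷ false ∷ false ∷ true ∷ []) ∷
  (false ∷ false ∷ true ∷ true ∷ false ∷ false ∷ true ∷ []) ∷
  (true ∷ false ∷ false ∷ false ∷ true ∷ false ∷ true ∷ []) ∷
  (false ∷ false ∷ false ∷ true ∷ true ∷ false ∷ true ∷ []) ∷
  (false ∷ true ∷ true ∷ false ∷ false ∷ true ∷ true ∷ []) ∷
  (false ∷ false ∷ true ∷ true ∷ false ∷ true ∷ true ∷ []) ∷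
  (true ∷ false ∷ false ∷ false ∷ true ∷ true ∷ true ∷ []) ∷
  (false ∷ false ∷ false ∷ true ∷ true ∷ true ∷ true ∷ []) ∷ []

pendantProfiles1 : List (List Bool)
pendantProfiles1 =
  (true ∷ true ∷ true ∷ true ∷ true ∷ false ∷ false ∷ []) ∷
  (true ∷ true ∷ false ∷ false ∷ false ∷ false ∷ true ∷ []) ∷
  (false ∷ false ∷ true ∷ true ∷ false ∷ false ∷ true ∷ []) ∷
  (true ∷ false ∷ false ∷ false ∷ true ∷ false ∷ true ∷ []) ∷
  (false ∷ false ∷ false ∷ true ∷ true ∷ false ∷ true ∷ []) ∷
  (true ∷ true ∷ false ∷ false ∷ false ∷ true ∷ true ∷ []) ∷
  (false ∷ false ∷ true ∷ true ∷ false ∷ true ∷ true ∷ []) ∷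
  (true ∷ false ∷ false ∷ false ∷ true ∷ true ∷ true ∷ []) ∷
  (false ∷ false ∷ false ∷ true ∷ true ∷ true ∷ true ∷ []) ∷ []

pendantProfiles2 : List (List Bool)
pendantProfiles2 =
  (true ∷ true ∷ true ∷ true ∷ true ∷ false ∷ false ∷ []) ∷
  (true ∷ true ∷ false ∷ false ∷ false ∷ false ∷ true ∷ []) ∷
  (false ∷ true ∷ true ∷ false ∷ false ∷ false ∷ true ∷ []) ∷
  (true ∷ false ∷ false ∷ false ∷ true ∷ false ∷ true ∷ []) ∷
  (false ∷ false ∷ false ∷ true ∷ true ∷ false ∷ true ∷ []) ∷
  (true ∷ true ∷ false ∷ false ∷ false ∷ true ∷ true ∷ []) ∷
  (false ∷ true ∷ true ∷ false ∷ false ∷ true ∷ true ∷ []) ∷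
  (true ∷ false ∷ false ∷ false ∷ true ∷ true ∷ true ∷ []) ∷
  (false ∷ false ∷ false ∷ true ∷ true ∷ true ∷ true ∷ []) ∷ []

pendantProfiles3 : List (List Bool)
pendantProfiles3 =
  (true ∷ true ∷ true ∷ true ∷ true ∷ false ∷ false ∷ []) ∷
  (true ∷ true ∷ false ∷ false ∷ false ∷ false ∷ true ∷ []) ∷
  (false ∷ true ∷ true ∷ false ∷ false ∷ false ∷ true ∷ []) ∷
  (false ∷ false ∷ true ∷ true ∷ false ∷ false ∷ true ∷ []) ∷
  (true ∷ false ∷ false ∷ false ∷ true ∷ false ∷ true ∷ []) ∷
  (true ∷ true ∷ false ∷ false ∷ false ∷ true ∷ true ∷ []) ∷
  (false ∷ true ∷ true ∷ false ∷ false ∷ true ∷ true ∷ []) ∷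
  (false ∷ false ∷ true ∷ true ∷ false ∷ true ∷ true ∷ []) ∷
  (true ∷ false ∷ false ∷ false ∷ true ∷ true ∷ true ∷ []) ∷ []

pendantProfiles4 : List (List Bool)
pendantProfiles4 =
  (true ∷ true ∷ true ∷ true ∷ true ∷ false ∷ false ∷ []) ∷
  (true ∷ true ∷ false ∷ false ∷ false ∷ false ∷ true ∷ []) ∷
  (false ∷ true ∷ true ∷ false ∷ false ∷ false ∷ true ∷ []) ∷
  (false ∷ false ∷ true ∷ true ∷ false ∷ false ∷ true ∷ []) ∷
  (false ∷ false ∷ false ∷ true ∷ true ∷ false ∷ true ∷ []) ∷
  (true ∷ true ∷ false ∷ false ∷ false ∷ true ∷ true ∷ []) ∷
  (false ∷ true ∷ true ∷ false ∷ false ∷ true ∷ true ∷ []) ∷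
  (false ∷ false ∷ true ∷ true ∷ false ∷ true ∷ true ∷ []) ∷
  (false ∷ false ∷ false ∷ true ∷ true ∷ true ∷ true ∷ []) ∷ []

pendantProfiles : ℕ → List (List Bool)
pendantProfiles 0 = pendantProfiles0
pendantProfiles 1 = pendantProfiles1
pendantProfiles 2 = pendantProfiles2
pendantProfiles 3 = pendantProfiles3
pendantProfiles _ = pendantProfiles4

opaque
  unfolding admissible

  pendant-profiles : ∀ r → (r <ᵇ 5) ≡ true → profilesWithinᵇ 7 (adjC5WithPendant r) (λ _ → false) (pendantProfiles r) ≡ true
  pendant-profiles 0 _ = refl
  pendant-profiles 1 _ = refl
  pendant-profiles 2 _ = refl
  pendant-profiles 3 _ = refl
  pendant-profiles 4 _ = refl

opaque
  unfolding everyIndependentQuadrupleᵇ admissible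

  pendant-no-independent-quadruple : ∀ r → (r <ᵇ 5) ≡ true →
    everyIndependentQuadrupleᵇ 7 (adjC5WithPendant r) (λ _ → false) (positions 7 (pendantProfiles r)) ≡ true
  pendant-no-independent-quadruple 0 _ = refl
  pendant-no-independent-quadruple 1 _ = refl
  pendant-no-independent-quadruple 2 _ = refl
  pendant-no-independent-quadruple 3 _ = refl
  pendant-no-independent-quadruple 4 _ = refl

nearC5Profiles : List (List Bool)
nearC5Profiles =
  (true ∷ true ∷ false ∷ false ∷ false ∷ []) ∷
  (false ∷ true ∷ true ∷ false ∷ false ∷ []) ∷
  (true ∷ true ∷ true ∷ false ∷ false ∷ []) ∷
  (false ∷ false ∷ true ∷ true ∷ false ∷ []) ∷
  (false ∷ true ∷ true ∷ true ∷ false ∷ []) ∷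
  (true ∷ true ∷ true ∷ true ∷ false ∷ []) ∷
  (true ∷ false ∷ false ∷ false ∷ true ∷ []) ∷
  (true ∷ true ∷ false ∷ false ∷ true ∷ []) ∷
  (true ∷ true ∷ true ∷ false ∷ true ∷ []) ∷
  (false ∷ false ∷ false ∷ true ∷ true ∷ []) ∷
  (true ∷ false ∷ false ∷ true ∷ true ∷ []) ∷
  (true ∷ true ∷ false ∷ true ∷ true ∷ []) ∷
  (false ∷ false ∷ true ∷ true ∷ true ∷ []) ∷
  (true ∷ false ∷ true ∷ true ∷ true ∷ []) ∷
  (false ∷ true ∷ true ∷ true ∷ true ∷ []) ∷
  (true ∷ true ∷ true ∷ true ∷ true ∷ []) ∷ []

opaque
  unfolding admissible

  near-C5-profiles : profilesWithinᵇ 5 adjC5 (emptyOnᵇ 5) nearC5Profiles ≡ true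
  near-C5-profiles = refl

-- An E₁ is the cycle with three further vertices on three consecutive edges r, r+1, r+2.
consecutiveEdgesFromᵇ : ℕ → List (List Bool) → Bool
consecutiveEdgesFromᵇ r os = (edgeProfile r ∈ᴮ os) ∧ (edgeProfile ((1 + r) % 5) ∈ᴮ os) ∧ (edgeProfile ((2 + r) % 5) ∈ᴮ os)

firstConsecutiveEdges : List (List Bool) → ℕ
firstConsecutiveEdges os =
  if consecutiveEdgesFromᵇ 0 os then 0 else if consecutiveEdgesFromᵇ 1 os then 1 else
  if consecutiveEdgesFromᵇ 2 os then 2 else if consecutiveEdgesFromᵇ 3 os then 3 else 4

e1Index : ℕ → List (List Bool) → Fin 8 → ℕ
e1Index r os a = if toℕ a <ᵇ 5 then (toℕ a + r) % 5 else 5 + indexᴮ (edgeProfile ((toℕ a ∸ 5 + r) % 5)) os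

spansE1ᵇ : List (List Bool) → Bool
spansE1ᵇ os =
  matchesᵇ (5 + length os) (entry (memoise (5 + length os) (extendedTable 5 adjC5 os noEdges))) E1 (e1Index (firstConsecutiveEdges os) os)

opaque
  unfolding everyIndependentQuadrupleᵇ admissible

  independent-quadruple-near-C5-spans-E1 :
    everyIndependentQuadrupleᵇ 5 adjC5 (spansE1ᵇ ∘ offCoreProfiles) (positions 5 nearC5Profiles) ≡ true
  independent-quadruple-near-C5-spans-E1 = refl

twinFree-E1 : twinFreeᵇ E1 ≡ true
twinFree-E1 = refl

module Quadruple (G : Graph) (s : Fin 4 → V G) (s-injective : Injective _≡_ _≡_ s)
                 (s-independent : ∀ i j → adj G (s i) (s j) ≡ false) where

  ss : List (V G)
  ss = map s (allFin 4)

  ss-independent : ∀ {v w} → v ∈ ss → w ∈ ss → adj G v w ≡ false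
  ss-independent v∈ w∈ with ∈-map⁻ s v∈ | ∈-map⁻ s w∈
  ... | i , _ , refl | j , _ , refl = s-independent i j

  ss-unique : Unique ss
  ss-unique = Unique.map⁺ s-injective (Unique.allFin⁺ 4)

  ssʳ : List (V G)
  ssʳ = map s (3F ∷ 2F ∷ 1F ∷ 0F ∷ [])

  ssʳ-⊆ : ∀ {v} → v ∈ ssʳ → v ∈ ss
  ssʳ-⊆ v∈ with ∈-map⁻ s v∈
  ... | i , _ , refl = ∈-map⁺ s (∈-allFin i)

  ssʳ-unique : Unique ssʳ
  ssʳ-unique = Unique.map⁺ s-injective
    (((λ ()) ∷ (λ ()) ∷ (λ ()) ∷ []) ∷ ((λ ()) ∷ (λ ()) ∷ []) ∷ ((λ ()) ∷ []) ∷ [] ∷ [])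

module C5Analysis {G : Graph} (connected : Connected G)
  (clawFree : ¬ ContainsInduced G claw) (twoK1∪K3Free : ¬ ContainsInduced G twoK1∪K3)
  (s : Fin 4 → V G) (s-injective : Injective _≡_ _≡_ s) (s-independent : ∀ i j → adj G (s i) (s j) ≡ false)
  (c : InducedEmbedding (C 5) G) where

  open Quadruple G s s-injective s-independent

  cycle : ℕ → V G
  cycle i = f c (toFin 4 i)

  coreC5 : Core G
  coreC5 = record { coreSize = 5 ; coreAdj = adjC5 ; coreVertex = cycle
                  ; coreAdj-agrees = λ i j → ≡.sym (adjPre c (toFin 4 i) (toFin 4 j)) }

  Near Far : V G → Set
  Near v = Σ ℕ λ h → (h <ᵇ 5) ≡ true × adj G v (cycle h) ≡ true
  Far v = ∀ h → (h <ᵇ 5) ≡ true → adj G v (cycle h) ≡ false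

  near-or-far : ∀ v → Near v ⊎ Far v
  near-or-far v with anyBelowᵇ 5 (λ h → adj G v (cycle h)) in some
  ... | true = inj₁ (anyBelowᵇ-sound 5 _ some)
  ... | false = inj₂ λ h h< → ≢true⇒≡false λ vh →
                  true≢false (trans (≡.sym (anyBelowᵇ-complete 5 (λ h → adj G v (cycle h)) h h< vh)) some)

  far-outside : ∀ w → Far w → OutsideCore coreC5 w
  far-outside w far h h< refl with successor h h<
    where
    successor : ∀ h → (h <ᵇ 5) ≡ true → Σ ℕ λ h′ → (h′ <ᵇ 5) ≡ true × adjC5 h h′ ≡ true
    successor 0 _ = 1 , refl , refl
    successor 1 _ = 2 , refl , refl
    successor 2 _ = 3 , refl , refl
    successor 3 _ = 4 , refl , refl
    successor 4 _ = 0 , refl , refl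
  ... | h′ , h′< , hh′ = true≢false (trans (≡.sym hh′) (trans (coreAdj-agrees coreC5 h h′) (far h′ h′<)))

  near-nonempty : ∀ u → Near u → emptyOnᵇ 5 (profile coreC5 u) ≡ false
  near-nonempty u (h , h< , uh)
    rewrite anyBelowᵇ-complete 5 (lookupOr false (profile coreC5 u)) h h< (trans (profile-at coreC5 u h h<) uh) = refl

  far-profile : ∀ w → Far w → profile coreC5 w ≡ noNeighbours₅
  far-profile w far rewrite far 0 refl | far 1 refl | far 2 refl | far 3 refl | far 4 refl = refl

  neighbour-of-far : ∀ u w → adj G u w ≡ true → Far w → Near u →
                     Σ ℕ λ r → (r <ᵇ 5) ≡ true × profile coreC5 u ≡ edgeProfile r
  neighbour-of-far u w uw far near = indexᴮ (profile coreC5 u) edgeProfiles , ∈ᴮ⇒indexᴮ _ edgeProfiles is-edgeProfile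
    where
    pair-agrees : ∀ x y → (x <ᵇ 2) ≡ true → (y <ᵇ 2) ≡ true →
                  adjacentPair x y ≡ adj G (lookupOr (cycle 0) (u ∷ w ∷ []) x) (lookupOr (cycle 0) (u ∷ w ∷ []) y)
    pair-agrees 0 0 _ _ = ≡.sym (irrefl G u)
    pair-agrees 0 1 _ _ = ≡.sym uw
    pair-agrees 1 0 _ _ = ≡.sym (trans (sym G w u) uw)
    pair-agrees 1 1 _ _ = ≡.sym (irrefl G w)
    u-outside : OutsideCore coreC5 u
    u-outside h h< refl = true≢false (trans (≡.sym (trans (sym G w (cycle h)) uw)) (far h h<))
    admissible-pair : admissible 5 adjC5 (profile coreC5 u ∷ noNeighbours₅ ∷ []) adjacentPair (isNew 5) ≡ true
    admissible-pair = subst (λ p → admissible 5 adjC5 (profile coreC5 u ∷ p ∷ []) adjacentPair (isNew 5) ≡ true)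
                            (far-profile w far)
      (Extension.admissible-realised coreC5 (u ∷ w ∷ []) adjacentPair pair-agrees (u-outside ∷ far-outside w far ∷ [])
        ((adjacent⇒≢ G uw ∷ []) ∷ [] ∷ []) clawFree twoK1∪K3Free (isNew 5))
    is-edgeProfile : profile coreC5 u ∈ᴮ edgeProfiles ≡ true
    is-edgeProfile =
      ∨-resolveˡ (implies-true (allBitListsᵇ-sound 5 neighbourOfFarᵇ neighbour-of-far-profiles (profile coreC5 u) (length-profile coreC5 u))
                               admissible-pair)
                 (near-nonempty u near)

  module Pendant (u w : V G) (uw : adj G u w ≡ true) (far : Far w) (r : ℕ) (r< : (r <ᵇ 5) ≡ true)
                 (u-profile : profile coreC5 u ≡ edgeProfile r) where

    pendantVertex : ℕ → V G
    pendantVertex i = if i <ᵇ 5 then cycle i else (if i ≡ᵇ 5 then u else w)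

    private
      u-at : ∀ i → (i <ᵇ 5) ≡ true → lookupOr false (edgeProfile r) i ≡ adj G u (cycle i)
      u-at i i< = trans (cong (λ p → lookupOr false p i) (≡.sym u-profile)) (profile-at coreC5 u i i<)

      agrees : ∀ i j → adjC5WithPendant r i j ≡ adj G (pendantVertex i) (pendantVertex j)
      agrees i j with i <ᵇ 5 in i< | j <ᵇ 5 in j<
      ... | true | true = coreAdj-agrees coreC5 i j
      ... | true | false with j ≡ᵇ 5
      ...   | true = trans (u-at i i<) (sym G u (cycle i))
      ...   | false = ≡.sym (trans (sym G (cycle i) w) (far i i<))
      agrees i j | false | true with i ≡ᵇ 5
      ...   | true = u-at j j<
      ...   | false = ≡.sym (far j j<)
      agrees i j | false | false with i ≡ᵇ 5 | j ≡ᵇ 5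
      ...   | true | true = ≡.sym (irrefl G u)
      ...   | true | false = ≡.sym uw
      ...   | false | true = ≡.sym (trans (sym G w u) uw)
      ...   | false | false = ≡.sym (irrefl G w)

    corePendant : Core G
    corePendant = record { coreSize = 7 ; coreAdj = adjC5WithPendant r ; coreVertex = pendantVertex ; coreAdj-agrees = agrees }

    private
      allowed-profiles : ∀ v → v ∈ ss → OutsideCore corePendant v → profile corePendant v ∈ pendantProfiles r
      allowed-profiles v _ v-outside =
        ∈ᴮ⇒∈ _ _ (profile-within clawFree twoK1∪K3Free corePendant v v-outside (λ _ → false) (pendantProfiles r)
                                 (pendant-profiles r r<) refl)

    impossible : ⊥
    impossible = true≢false (≡.sym (IndependentSet.conclusion-holds clawFree twoK1∪K3Free corePendant ss ss-independent
                   (pendantProfiles r) allowed-profiles (λ _ → false) (pendant-no-independent-quadruple r r<) ss-unique refl))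

  near-far-disjoint : ∀ {x} → Near x → Far x → ⊥
  near-far-disjoint (h , h< , xh) far = true≢false (trans (≡.sym xh) (far h h<))

  neighbour-of-far-impossible : ∀ u w → adj G u w ≡ true → Far w → Near u → ⊥
  neighbour-of-far-impossible u w uw far near with neighbour-of-far u w uw far near
  ... | r , r< , u-profile = Pendant.impossible u w uw far r r< u-profile

  all-near : ∀ v → Near v
  all-near v with near-or-far v
  ... | inj₁ near = near
  ... | inj₂ far
      with crossing-edge G near-or-far near-far-disjoint (connected v (cycle 0)) far (1 , refl , ≡.sym (coreAdj-agrees coreC5 0 1))
  ...   | w , u , wu , far-w , near-u = ⊥-elim (neighbour-of-far-impossible u w (trans (sym G u w) wu) far-w near-u)

  private
    near-profiles : ∀ v → v ∈ ss → OutsideCore coreC5 v → profile coreC5 v ∈ nearC5Profiles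
    near-profiles v _ v-outside =
      ∈ᴮ⇒∈ _ _ (profile-within clawFree twoK1∪K3Free coreC5 v v-outside (emptyOnᵇ 5) nearC5Profiles near-C5-profiles
                               (near-nonempty v (all-near v)))

  open IndependentSet clawFree twoK1∪K3Free coreC5 ss ss-independent nearC5Profiles near-profiles (spansE1ᵇ ∘ offCoreProfiles)

  spans-E1 : InducedEmbedding E1 G
  spans-E1 = embedding-of-match outsiders-realisation E1 (e1Index (firstConsecutiveEdges profiles) profiles) match twinFree-E1
    where
    outsiders : List (V G)
    outsiders = offCoreVertices ssʳ
    profiles : List (List Bool)
    profiles = map (profile coreC5) outsiders
    outsiders-realisation : Realisation G
    outsiders-realisation =
      Extension.realisation coreC5 outsiders noEdges (independent-agrees outsiders (ssʳ-⊆ ∘ offCoreVertices-⊆ ssʳ))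
                            (offCoreVertices-outside ssʳ) (Unique-offCoreVertices ssʳ ssʳ-unique)
    quadruple-spans : spansE1ᵇ (offCoreProfiles (map positionOf ssʳ)) ≡ true
    quadruple-spans = conclusion-holds independent-quadruple-near-C5-spans-E1 ss-unique refl
    match : spansE1ᵇ profiles ≡ true
    match = subst (λ os → spansE1ᵇ os ≡ true) (offCoreProfiles-positionOf ssʳ) quadruple-spans

-- Around an induced E₁

adjE1 : ℕ → ℕ → Bool
adjE1 i j = adj E1 (toFin 7 i) (toFin 7 j)

-- In order: x_A, the mirror image of x_C, x_C, the mirror image of x_A, and x_B, where the mirror is the
-- automorphism u₁ ↔ u₄, u₂ ↔ u₃, w₁ ↔ w₃ of H₆.
e1Types : List (List Bool)
e1Types =
  (false ∷ false ∷ false ∷ true ∷ true ∷ true ∷ false ∷ false ∷ []) ∷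
  (true ∷ true ∷ true ∷ false ∷ true ∷ false ∷ true ∷ false ∷ []) ∷
  (false ∷ true ∷ true ∷ true ∷ true ∷ false ∷ true ∷ false ∷ []) ∷
  (true ∷ false ∷ false ∷ false ∷ true ∷ false ∷ false ∷ true ∷ []) ∷
  (true ∷ true ∷ true ∷ true ∷ false ∷ true ∷ false ∷ true ∷ []) ∷ []

e1Type : ℕ → List Bool
e1Type t = lookupOr [] e1Types t

typesCompatible typesAdjacent : List (List Bool)
typesCompatible =
  (false ∷ false ∷ true ∷ false ∷ true ∷ []) ∷
  (false ∷ false ∷ false ∷ true ∷ true ∷ []) ∷
  (true ∷ false ∷ false ∷ false ∷ true ∷ []) ∷
  (false ∷ true ∷ false ∷ false ∷ true ∷ []) ∷
  (true ∷ true ∷ true ∷ true ∷ false ∷ []) ∷ []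
typesAdjacent =
  (false ∷ false ∷ true ∷ false ∷ false ∷ []) ∷
  (false ∷ false ∷ false ∷ true ∷ false ∷ []) ∷
  (true ∷ false ∷ false ∷ false ∷ false ∷ []) ∷
  (false ∷ true ∷ false ∷ false ∷ false ∷ []) ∷
  (false ∷ false ∷ false ∷ false ∷ false ∷ []) ∷ []

typesCompatibleᵇ typesAdjacentᵇ : ℕ → ℕ → Bool
typesCompatibleᵇ t t′ = lookupOr false (lookupOr [] typesCompatible t) t′
typesAdjacentᵇ t t′ = lookupOr false (lookupOr [] typesAdjacent t) t′

bothᵇ : (Bool → Bool) → Bool
bothᵇ p = p true ∧ p false

bothᵇ-sound : ∀ p → bothᵇ p ≡ true → ∀ b → p b ≡ true
bothᵇ-sound p h true = ∧-conicalˡ (p true) _ h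
bothᵇ-sound p h false = ∧-conicalʳ (p true) _ h

pairWith : Bool → ℕ → ℕ → Bool
pairWith b x y = not (x ≡ᵇ y) ∧ b

typePairᵇ : ℕ → ℕ → Bool → Bool
typePairᵇ t t′ b = typesCompatibleᵇ t t′ ∧ (b == typesAdjacentᵇ t t′)

typePairAdmissibleᵇ : ℕ → ℕ → Bool → Bool
typePairAdmissibleᵇ t t′ b =
  not (admissible 8 adjE1 (e1Type t ∷ e1Type t′ ∷ []) (pairWith b) (isNew 8)) ∨ typePairᵇ t t′ b

opaque
  unfolding admissible

  near-E1-types : profilesWithinᵇ 8 adjE1 (emptyOnᵇ 5) e1Types ≡ true
  near-E1-types = refl

  type-pairs : allBelowᵇ 5 (λ t → allBelowᵇ 5 (λ t′ → bothᵇ (typePairAdmissibleᵇ t t′))) ≡ true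
  type-pairs = refl

types-self-incompatible : allBelowᵇ 5 (λ t → not (typesCompatibleᵇ t t)) ≡ true
types-self-incompatible = refl

cycleEdgeInE1ᵇ : Fin 5 → Fin 5 → Bool
cycleEdgeInE1ᵇ a b = adjE1 (toℕ a) (toℕ b) == adj (C 5) a b

C5-in-E1 : allFinᵇ 5 (λ a → allFinᵇ 5 (cycleEdgeInE1ᵇ a)) ≡ true
C5-in-E1 = refl

twinFree-C5 : twinFreeᵇ (C 5) ≡ true
twinFree-C5 = refl

-- The 13 vertex classes: 0–7 are the vertices of the copy of E₁, 8 + t the vertices of type t.
classAdj : ℕ → ℕ → Bool
classAdj c d =
  if c <ᵇ 8 then (if d <ᵇ 8 then adjE1 c d else lookupOr false (e1Type (d ∸ 8)) c)
  else (if d <ᵇ 8 then lookupOr false (e1Type (c ∸ 8)) d else typesAdjacentᵇ (c ∸ 8) (d ∸ 8))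

classAdj-irreflexive : allBelowᵇ 13 (λ c → not (classAdj c c)) ≡ true
classAdj-irreflexive = refl

classEdgeMatchesᵇ : (E : Graph) → (ℕ → V E) → List Bool → ℕ → ℕ → Bool
classEdgeMatchesᵇ E label present c d =
  not (lookupOr false present c ∧ lookupOr false present d) ∨ (adj E (label c) (label d) == classAdj c d)

labelCoveredᵇ : (E : Graph) → (ℕ → V E) → (V E → ℕ) → List Bool → V E → Bool
labelCoveredᵇ E label back present l =
  and ((back l <ᵇ 13) ∷ lookupOr false present (back l) ∷ (toℕ (label (back l)) ≡ᵇ toℕ l) ∷ [])

labelInvertedᵇ : (E : Graph) → (ℕ → V E) → (V E → ℕ) → List Bool → ℕ → Bool
labelInvertedᵇ E label back present c = not (lookupOr false present c) ∨ (back (label c) ≡ᵇ c)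

isoCertificateᵇ : (E : Graph) → (ℕ → V E) → (V E → ℕ) → List Bool → Bool
isoCertificateᵇ E label back present =
  allBelowᵇ 13 (λ c → allBelowᵇ 13 (classEdgeMatchesᵇ E label present c)) ∧
  allFinᵇ (n E) (labelCoveredᵇ E label back present) ∧
  allBelowᵇ 13 (labelInvertedᵇ E label back present)

presence : Bool → Bool → Bool → Bool → Bool → List Bool
presence b0 b1 b2 b3 b4 = true ∷ true ∷ true ∷ true ∷ true ∷ true ∷ true ∷ true ∷ b0 ∷ b1 ∷ b2 ∷ b3 ∷ b4 ∷ []

-- label sends each present class to a vertex of E and back inverts it; entries of absent classes are ignored.
record IsoCertificate (E : Graph) (present : List Bool) : Set where
  field
    label : ℕ → V E
    back : V E → ℕ
    valid : isoCertificateᵇ E label back present ≡ true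

relabel : (k : ℕ) → List ℕ → ℕ → Fin (suc k)
relabel k labels c = toFin k (lookupOr 0 labels c)

unlabel : ∀ {k} → List ℕ → Fin k → ℕ
unlabel labels l = lookupOr 0 labels (toℕ l)

iso-none : IsoCertificate E1 (presence false false false false false)
iso-none = record
  { label = relabel 7 (0 ∷ 1 ∷ 2 ∷ 3 ∷ 4 ∷ 5 ∷ 6 ∷ 7 ∷ 0 ∷ 0 ∷ 0 ∷ 0 ∷ 0 ∷ [])
  ; back = unlabel (0 ∷ 1 ∷ 2 ∷ 3 ∷ 4 ∷ 5 ∷ 6 ∷ 7 ∷ [])
  ; valid = refl
  }

iso-B : IsoCertificate E3 (presence false false false false true)
iso-B = record
  { label = relabel 8 (0 ∷ 1 ∷ 2 ∷ 3 ∷ 4 ∷ 5 ∷ 6 ∷ 7 ∷ 0 ∷ 0 ∷ 0 ∷ 0 ∷ 8 ∷ [])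
  ; back = unlabel (0 ∷ 1 ∷ 2 ∷ 3 ∷ 4 ∷ 5 ∷ 6 ∷ 7 ∷ 12 ∷ [])
  ; valid = refl
  }

iso-A′ : IsoCertificate E2 (presence false false false true false)
iso-A′ = record
  { label = relabel 8 (3 ∷ 2 ∷ 1 ∷ 0 ∷ 4 ∷ 7 ∷ 6 ∷ 5 ∷ 0 ∷ 0 ∷ 0 ∷ 8 ∷ 0 ∷ [])
  ; back = unlabel (3 ∷ 2 ∷ 1 ∷ 0 ∷ 4 ∷ 7 ∷ 6 ∷ 5 ∷ 11 ∷ [])
  ; valid = refl
  }

iso-A′B : IsoCertificate E5 (presence false false false true true)
iso-A′B = record
  { label = relabel 9 (3 ∷ 2 ∷ 1 ∷ 0 ∷ 4 ∷ 7 ∷ 6 ∷ 5 ∷ 0 ∷ 0 ∷ 0 ∷ 8 ∷ 9 ∷ [])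
  ; back = unlabel (3 ∷ 2 ∷ 1 ∷ 0 ∷ 4 ∷ 7 ∷ 6 ∷ 5 ∷ 11 ∷ 12 ∷ [])
  ; valid = refl
  }

iso-C : IsoCertificate E4 (presence false false true false false)
iso-C = record
  { label = relabel 8 (0 ∷ 1 ∷ 2 ∷ 3 ∷ 4 ∷ 5 ∷ 6 ∷ 7 ∷ 0 ∷ 0 ∷ 8 ∷ 0 ∷ 0 ∷ [])
  ; back = unlabel (0 ∷ 1 ∷ 2 ∷ 3 ∷ 4 ∷ 5 ∷ 6 ∷ 7 ∷ 10 ∷ [])
  ; valid = refl
  }

iso-CB : IsoCertificate E7 (presence false false true false true)
iso-CB = record
  { label = relabel 9 (0 ∷ 1 ∷ 2 ∷ 3 ∷ 4 ∷ 5 ∷ 6 ∷ 7 ∷ 0 ∷ 0 ∷ 9 ∷ 0 ∷ 8 ∷ [])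
  ; back = unlabel (0 ∷ 1 ∷ 2 ∷ 3 ∷ 4 ∷ 5 ∷ 6 ∷ 7 ∷ 12 ∷ 10 ∷ [])
  ; valid = refl
  }

iso-C′ : IsoCertificate E4 (presence false true false false false)
iso-C′ = record
  { label = relabel 8 (3 ∷ 2 ∷ 1 ∷ 0 ∷ 4 ∷ 7 ∷ 6 ∷ 5 ∷ 0 ∷ 8 ∷ 0 ∷ 0 ∷ 0 ∷ [])
  ; back = unlabel (3 ∷ 2 ∷ 1 ∷ 0 ∷ 4 ∷ 7 ∷ 6 ∷ 5 ∷ 9 ∷ [])
  ; valid = refl
  }

iso-C′B : IsoCertificate E7 (presence false true false false true)
iso-C′B = record
  { label = relabel 9 (3 ∷ 2 ∷ 1 ∷ 0 ∷ 4 ∷ 7 ∷ 6 ∷ 5 ∷ 0 ∷ 9 ∷ 0 ∷ 0 ∷ 8 ∷ [])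
  ; back = unlabel (3 ∷ 2 ∷ 1 ∷ 0 ∷ 4 ∷ 7 ∷ 6 ∷ 5 ∷ 12 ∷ 9 ∷ [])
  ; valid = refl
  }

iso-C′A′ : IsoCertificate E6 (presence false true false true false)
iso-C′A′ = record
  { label = relabel 9 (3 ∷ 2 ∷ 1 ∷ 0 ∷ 4 ∷ 7 ∷ 6 ∷ 5 ∷ 0 ∷ 9 ∷ 0 ∷ 8 ∷ 0 ∷ [])
  ; back = unlabel (3 ∷ 2 ∷ 1 ∷ 0 ∷ 4 ∷ 7 ∷ 6 ∷ 5 ∷ 11 ∷ 9 ∷ [])
  ; valid = refl
  }

iso-C′A′B : IsoCertificate E8 (presence false true false true true)
iso-C′A′B = record
  { label = relabel 10 (3 ∷ 2 ∷ 1 ∷ 0 ∷ 4 ∷ 7 ∷ 6 ∷ 5 ∷ 0 ∷ 10 ∷ 0 ∷ 8 ∷ 9 ∷ [])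
  ; back = unlabel (3 ∷ 2 ∷ 1 ∷ 0 ∷ 4 ∷ 7 ∷ 6 ∷ 5 ∷ 11 ∷ 12 ∷ 9 ∷ [])
  ; valid = refl
  }

iso-A : IsoCertificate E2 (presence true false false false false)
iso-A = record
  { label = relabel 8 (0 ∷ 1 ∷ 2 ∷ 3 ∷ 4 ∷ 5 ∷ 6 ∷ 7 ∷ 8 ∷ 0 ∷ 0 ∷ 0 ∷ 0 ∷ [])
  ; back = unlabel (0 ∷ 1 ∷ 2 ∷ 3 ∷ 4 ∷ 5 ∷ 6 ∷ 7 ∷ 8 ∷ [])
  ; valid = refl
  }

iso-AB : IsoCertificate E5 (presence true false false false true)
iso-AB = record
  { label = relabel 9 (0 ∷ 1 ∷ 2 ∷ 3 ∷ 4 ∷ 5 ∷ 6 ∷ 7 ∷ 8 ∷ 0 ∷ 0 ∷ 0 ∷ 9 ∷ [])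
  ; back = unlabel (0 ∷ 1 ∷ 2 ∷ 3 ∷ 4 ∷ 5 ∷ 6 ∷ 7 ∷ 8 ∷ 12 ∷ [])
  ; valid = refl
  }

iso-AC : IsoCertificate E6 (presence true false true false false)
iso-AC = record
  { label = relabel 9 (0 ∷ 1 ∷ 2 ∷ 3 ∷ 4 ∷ 5 ∷ 6 ∷ 7 ∷ 8 ∷ 0 ∷ 9 ∷ 0 ∷ 0 ∷ [])
  ; back = unlabel (0 ∷ 1 ∷ 2 ∷ 3 ∷ 4 ∷ 5 ∷ 6 ∷ 7 ∷ 8 ∷ 10 ∷ [])
  ; valid = refl
  }

iso-ACB : IsoCertificate E8 (presence true false true false true)
iso-ACB = record
  { label = relabel 10 (0 ∷ 1 ∷ 2 ∷ 3 ∷ 4 ∷ 5 ∷ 6 ∷ 7 ∷ 8 ∷ 0 ∷ 10 ∷ 0 ∷ 9 ∷ [])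
  ; back = unlabel (0 ∷ 1 ∷ 2 ∷ 3 ∷ 4 ∷ 5 ∷ 6 ∷ 7 ∷ 8 ∷ 12 ∷ 10 ∷ [])
  ; valid = refl
  }


toℕ-toFin : ∀ k i → (i <ᵇ suc k) ≡ true → toℕ (toFin k i) ≡ i
toℕ-toFin k i i< = trans (toℕ-fromℕ< _) (m<n⇒m%n≡m (<ᵇ⇒< i (suc k) (≡true⇒T i<)))

module ClassIsomorphism (G : Graph) (class : V G → ℕ) (present : ℕ → Bool)
  (class-adj : ∀ v w → adj G v w ≡ classAdj (class v) (class w))
  (class-injective : ∀ v w → class v ≡ class w → v ≡ w)
  (class-present : ∀ v → present (class v) ≡ true)
  (present-inhabited : ∀ c → present c ≡ true → Σ (V G) λ v → class v ≡ c)
  (class-bounded : ∀ v → (class v <ᵇ 13) ≡ true) where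

  iso-from-certificate : ∀ (E : Graph) {pv : List Bool} → IsoCertificate E pv →
                         (∀ c → (c <ᵇ 13) ≡ true → lookupOr false pv c ≡ present c) → Iso G E
  iso-from-certificate E {pv} record { label = label ; back = back ; valid = certificate } pv-present =
    record { emb = record { f = label ∘ class ; inj = injective ; adjPre = preserves } ; surj = surjective }
    where
    edges : Bool
    edges = allBelowᵇ 13 (λ c → allBelowᵇ 13 (classEdgeMatchesᵇ E label pv c))
    covering : allFinᵇ (n E) (labelCoveredᵇ E label back pv) ≡ true
    covering = ∧-conicalˡ (allFinᵇ (n E) (labelCoveredᵇ E label back pv)) _ (∧-conicalʳ edges _ certificate)
    inverse : allBelowᵇ 13 (labelInvertedᵇ E label back pv) ≡ true
    inverse = ∧-conicalʳ (allFinᵇ (n E) (labelCoveredᵇ E label back pv)) _ (∧-conicalʳ edges _ certificate)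
    in-pv : ∀ v → lookupOr false pv (class v) ≡ true
    in-pv v = trans (pv-present (class v) (class-bounded v)) (class-present v)
    preserves : ∀ v w → adj E (label (class v)) (label (class w)) ≡ adj G v w
    preserves v w =
      trans (==⇒≡ (implies-true (allBelowᵇ²-sound 13 13 (classEdgeMatchesᵇ E label pv) (∧-conicalˡ edges _ certificate)
                                                   (class v) (class w) (class-bounded v) (class-bounded w))
                                 (cong₂ _∧_ (in-pv v) (in-pv w))))
            (≡.sym (class-adj v w))
    back-label : ∀ v → back (label (class v)) ≡ class v
    back-label v =
      ≡ᵇ-true⇒≡ _ _ (implies-true (allBelowᵇ-sound 13 (labelInvertedᵇ E label back pv) inverse (class v) (class-bounded v)) (in-pv v))
    injective : Injective _≡_ _≡_ (label ∘ class)
    injective {v} {w} eq = class-injective v w (trans (≡.sym (back-label v)) (trans (cong back eq) (back-label w)))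
    surjective : ∀ l → ∃ λ v → ∀ {x} → x ≡ v → label (class x) ≡ l
    surjective l with and-All ((back l <ᵇ 13) ∷ lookupOr false pv (back l) ∷ (toℕ (label (back l)) ≡ᵇ toℕ l) ∷ [])
                              (allFinᵇ-sound (n E) (labelCoveredᵇ E label back pv) covering l)
    ... | back< ∷ back-present ∷ label-back ∷ []
        with present-inhabited (back l) (trans (≡.sym (pv-present (back l) back<)) back-present)
    ... | v , class-v = v , λ { refl → toℕ-injective (trans (cong (toℕ ∘ label) class-v) (≡ᵇ-true⇒≡ _ _ label-back)) }

data IsomorphicToSomeE (G : Graph) : Set where
  ≅E1 : Iso G E1 → IsomorphicToSomeE G
  ≅E2 : Iso G E2 → IsomorphicToSomeE G
  ≅E3 : Iso G E3 → IsomorphicToSomeE G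
  ≅E4 : Iso G E4 → IsomorphicToSomeE G
  ≅E5 : Iso G E5 → IsomorphicToSomeE G
  ≅E6 : Iso G E6 → IsomorphicToSomeE G
  ≅E7 : Iso G E7 → IsomorphicToSomeE G
  ≅E8 : Iso G E8 → IsomorphicToSomeE G

module E1Analysis {G : Graph} (connected : Connected G)
  (clawFree : ¬ ContainsInduced G claw) (twoK1∪K3Free : ¬ ContainsInduced G twoK1∪K3)
  (s : Fin 4 → V G) (s-injective : Injective _≡_ _≡_ s) (s-independent : ∀ i j → adj G (s i) (s j) ≡ false)
  (e : InducedEmbedding E1 G) where

  e1Vertex : ℕ → V G
  e1Vertex i = f e (toFin 7 i)

  coreE1 : Core G
  coreE1 = record { coreSize = 8 ; coreAdj = adjE1 ; coreVertex = e1Vertex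
                  ; coreAdj-agrees = λ i j → ≡.sym (adjPre e (toFin 7 i) (toFin 7 j)) }

  private
    c5 : InducedEmbedding (C 5) G
    c5 = embedding-of-twinFree G (C 5) twinFree-C5 (e1Vertex ∘ toℕ) λ a b →
           trans (≡.sym (coreAdj-agrees coreE1 (toℕ a) (toℕ b)))
                 (==⇒≡ (allFinᵇ²-sound 5 cycleEdgeInE1ᵇ C5-in-E1 a b))

    near-E1 : ∀ v → emptyOnᵇ 5 (profile coreE1 v) ≡ false
    near-E1 v with C5Analysis.all-near connected clawFree twoK1∪K3Free s s-injective s-independent c5 v
    ... | h , h< , vh
      rewrite anyBelowᵇ-complete 5 (lookupOr false (profile coreE1 v)) h h<
                (trans (profile-at coreE1 v h (<ᵇ-+ʳ h 5 3 h<))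
                       (subst (λ i → adj G v (e1Vertex i) ≡ true) (toℕ-toFin 4 h h<) vh)) = refl

    e1Vertex-injective : ∀ h c → (h <ᵇ 8) ≡ true → (c <ᵇ 8) ≡ true → e1Vertex h ≡ e1Vertex c → h ≡ c
    e1Vertex-injective h c h< c< eq = trans (≡.sym (toℕ-toFin 7 h h<)) (trans (cong toℕ (inj e eq)) (toℕ-toFin 7 c c<))

  data View (v : V G) : Set where
    e1-vertex : ∀ h → (h <ᵇ 8) ≡ true → e1Vertex h ≡ v → View v
    typed : ∀ t → (t <ᵇ 5) ≡ true → OutsideCore coreE1 v → profile coreE1 v ≡ e1Type t → View v

  view : ∀ v → View v
  view v with locate coreE1 v
  ... | inj₁ (h , h< , eq) = e1-vertex h h< eq
  ... | inj₂ v-outside = typed (indexᴮ (profile coreE1 v) e1Types) (proj₁ indexed) v-outside (proj₂ indexed)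
    where
    indexed = ∈ᴮ⇒indexᴮ (profile coreE1 v) e1Types
                (profile-within clawFree twoK1∪K3Free coreE1 v v-outside (emptyOnᵇ 5) e1Types near-E1-types (near-E1 v))

  classOf : ∀ {v} → View v → ℕ
  classOf (e1-vertex h _ _) = h
  classOf (typed t _ _ _) = 8 + t

  class : V G → ℕ
  class v = classOf (view v)

  class-bounded : ∀ v → (class v <ᵇ 13) ≡ true
  class-bounded v with view v
  ... | e1-vertex h h< _ = <ᵇ-+ʳ h 8 5 h<
  ... | typed t t< _ _ = t<

  type-pair : ∀ v w t t′ → (t <ᵇ 5) ≡ true → (t′ <ᵇ 5) ≡ true → OutsideCore coreE1 v → OutsideCore coreE1 w → v ≢ w →
              profile coreE1 v ≡ e1Type t → profile coreE1 w ≡ e1Type t′ → typePairᵇ t t′ (adj G v w) ≡ true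
  type-pair v w t t′ t< t′< v-outside w-outside v≢w v-type w-type =
    implies-true (bothᵇ-sound (typePairAdmissibleᵇ t t′)
                   (allBelowᵇ²-sound 5 5 (λ t t′ → bothᵇ (typePairAdmissibleᵇ t t′)) type-pairs t t′ t< t′<) (adj G v w))
                 (subst₂ (λ p q → admissible 8 adjE1 (p ∷ q ∷ []) (pairWith (adj G v w)) (isNew 8) ≡ true) v-type w-type
                   (Extension.admissible-realised coreE1 (v ∷ w ∷ []) (pairWith (adj G v w)) pair-agrees
                     (v-outside ∷ w-outside ∷ []) ((v≢w ∷ []) ∷ [] ∷ []) clawFree twoK1∪K3Free (isNew 8)))
    where
    pair-agrees : ∀ x y → (x <ᵇ 2) ≡ true → (y <ᵇ 2) ≡ true →
                  pairWith (adj G v w) x y ≡ adj G (lookupOr (e1Vertex 0) (v ∷ w ∷ []) x) (lookupOr (e1Vertex 0) (v ∷ w ∷ []) y)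
    pair-agrees 0 0 _ _ = ≡.sym (irrefl G v)
    pair-agrees 0 1 _ _ = refl
    pair-agrees 1 0 _ _ = sym G v w
    pair-agrees 1 1 _ _ = ≡.sym (irrefl G w)

  private
    view-adj : ∀ v w → v ≢ w → (vv : View v) (vw : View w) → adj G v w ≡ classAdj (classOf vv) (classOf vw)
    view-adj v w _ (e1-vertex h h< refl) (e1-vertex h′ h′< refl) rewrite h< | h′< = ≡.sym (coreAdj-agrees coreE1 h h′)
    view-adj v w _ (e1-vertex h h< refl) (typed t′ _ _ w-type) rewrite h< =
      trans (sym G (e1Vertex h) w) (trans (≡.sym (profile-at coreE1 w h h<)) (cong (λ p → lookupOr false p h) w-type))
    view-adj v w _ (typed t _ _ v-type) (e1-vertex h′ h′< refl) rewrite h′< =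
      trans (≡.sym (profile-at coreE1 v h′ h′<)) (cong (λ p → lookupOr false p h′) v-type)
    view-adj v w v≢w (typed t t< v-outside v-type) (typed t′ t′< w-outside w-type) =
      ==⇒≡ (∧-conicalʳ (typesCompatibleᵇ t t′) _
              (type-pair v w t t′ t< t′< v-outside w-outside v≢w v-type w-type))

    view-classes-distinct : ∀ v w → v ≢ w → (vv : View v) (vw : View w) → classOf vv ≢ classOf vw
    view-classes-distinct v w v≢w (e1-vertex h _ ev) (e1-vertex h′ _ ew) eq =
      v≢w (trans (≡.sym ev) (trans (cong e1Vertex eq) ew))
    view-classes-distinct v w _ (e1-vertex h h< _) (typed t′ _ _ _) refl = true≢false (≡.sym h<)
    view-classes-distinct v w _ (typed t _ _ _) (e1-vertex h′ h′< _) eq =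
      true≢false (≡.sym (subst (λ x → (x <ᵇ 8) ≡ true) (≡.sym eq) h′<))
    view-classes-distinct v w v≢w (typed t t< v-outside v-type) (typed t′ t′< w-outside w-type) eq
      with +-cancelˡ-≡ 8 t t′ eq
    ... | refl = true≢false (trans (≡.sym (∧-conicalˡ (typesCompatibleᵇ t t) _
                                             (type-pair v w t t t< t′< v-outside w-outside v≢w v-type w-type)))
                                   (not-true (allBelowᵇ-sound 5 (λ t → not (typesCompatibleᵇ t t)) types-self-incompatible t t<)))

  class-adj : ∀ v w → adj G v w ≡ classAdj (class v) (class w)
  class-adj v w with v Fin.≟ w
  ... | yes refl =
    trans (irrefl G v) (≡.sym (not-true (allBelowᵇ-sound 13 (λ c → not (classAdj c c)) classAdj-irreflexive (class v) (class-bounded v))))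
  ... | no v≢w = view-adj v w v≢w (view v) (view w)

  class-injective : ∀ v w → class v ≡ class w → v ≡ w
  class-injective v w eq with v Fin.≟ w
  ... | yes v≡w = v≡w
  ... | no v≢w = ⊥-elim (view-classes-distinct v w v≢w (view v) (view w) eq)

  typePresentᵇ : ℕ → Bool
  typePresentᵇ t = anyFinᵇ (n G) (λ v → class v ≡ᵇ (8 + t))

  present : ℕ → Bool
  present c = (c <ᵇ 8) ∨ typePresentᵇ (c ∸ 8)

  class-present : ∀ v → present (class v) ≡ true
  class-present v with class v <ᵇ 8 in c<
  ... | true = refl
  ... | false = anyFinᵇ-complete (n G) (λ u → class u ≡ᵇ (8 + (class v ∸ 8))) v
                  (subst (λ x → (x ≡ᵇ (8 + (class v ∸ 8))) ≡ true) (m+[n∸m]≡n (<ᵇ-false⇒≥ (class v) 8 c<))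
                         (≡ᵇ-refl (8 + (class v ∸ 8))))

  present-inhabited : ∀ c → present c ≡ true → Σ (V G) λ v → class v ≡ c
  present-inhabited c p with c <ᵇ 8 in c<
  ... | true = e1Vertex c , class-e1Vertex
    where
    class-e1Vertex : class (e1Vertex c) ≡ c
    class-e1Vertex with view (e1Vertex c)
    ... | e1-vertex h h< eq = e1Vertex-injective h c h< c< eq
    ... | typed _ _ outside _ = ⊥-elim (outside c c< refl)
  ... | false with anyFinᵇ-sound (n G) (λ u → class u ≡ᵇ (8 + (c ∸ 8))) p
  ...   | v , class-v = v , trans (≡ᵇ-true⇒≡ _ _ class-v) (m+[n∸m]≡n (<ᵇ-false⇒≥ c 8 c<))

  presence-agrees : ∀ {b0 b1 b2 b3 b4} → typePresentᵇ 0 ≡ b0 → typePresentᵇ 1 ≡ b1 → typePresentᵇ 2 ≡ b2 →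
                    typePresentᵇ 3 ≡ b3 → typePresentᵇ 4 ≡ b4 →
                    ∀ c → (c <ᵇ 13) ≡ true → lookupOr false (presence b0 b1 b2 b3 b4) c ≡ present c
  presence-agrees _ _ _ _ _ 0 _ = refl
  presence-agrees _ _ _ _ _ 1 _ = refl
  presence-agrees _ _ _ _ _ 2 _ = refl
  presence-agrees _ _ _ _ _ 3 _ = refl
  presence-agrees _ _ _ _ _ 4 _ = refl
  presence-agrees _ _ _ _ _ 5 _ = refl
  presence-agrees _ _ _ _ _ 6 _ = refl
  presence-agrees _ _ _ _ _ 7 _ = refl
  presence-agrees q0 _ _ _ _ 8 _ = ≡.sym q0
  presence-agrees _ q1 _ _ _ 9 _ = ≡.sym q1
  presence-agrees _ _ q2 _ _ 10 _ = ≡.sym q2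
  presence-agrees _ _ _ q3 _ 11 _ = ≡.sym q3
  presence-agrees _ _ _ _ q4 12 _ = ≡.sym q4

  private
    typed-of-class : ∀ v t → class v ≡ 8 + t → OutsideCore coreE1 v × profile coreE1 v ≡ e1Type t × (t <ᵇ 5) ≡ true
    typed-of-class v t eq with view v
    ... | e1-vertex h h< _ = ⊥-elim (true≢false (≡.sym (subst (λ x → (x <ᵇ 8) ≡ true) eq h<)))
    ... | typed t₀ t₀< v-outside v-type with +-cancelˡ-≡ 8 t₀ t eq
    ...   | refl = v-outside , v-type , t₀<

    incompatible : ∀ t t′ → t ≢ t′ → typesCompatibleᵇ t t′ ≡ false →
                   typePresentᵇ t ≡ true → typePresentᵇ t′ ≡ true → ⊥
    incompatible t t′ t≢t′ incompatible-tt′ pt pt′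
      with anyFinᵇ-sound (n G) (λ u → class u ≡ᵇ (8 + t)) pt | anyFinᵇ-sound (n G) (λ u → class u ≡ᵇ (8 + t′)) pt′
    ... | v , class-v | w , class-w
      with typed-of-class v t (≡ᵇ-true⇒≡ _ _ class-v) | typed-of-class w t′ (≡ᵇ-true⇒≡ _ _ class-w)
    ...   | v-outside , v-type , t< | w-outside , w-type , t′< =
      true≢false (trans (≡.sym (∧-conicalˡ _ _ (type-pair v w t t′ t< t′< v-outside w-outside v≢w v-type w-type)))
                        incompatible-tt′)
      where
      v≢w : v ≢ w
      v≢w eq = t≢t′ (+-cancelˡ-≡ 8 t t′ (trans (≡.sym (≡ᵇ-true⇒≡ _ _ class-v))
                                              (trans (cong class eq) (≡ᵇ-true⇒≡ _ _ class-w))))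

  open ClassIsomorphism G class present class-adj class-injective class-present present-inhabited class-bounded

  isomorphic-to-some-E : IsomorphicToSomeE G
  isomorphic-to-some-E
    with typePresentᵇ 0 in q0 | typePresentᵇ 1 in q1 | typePresentᵇ 2 in q2 | typePresentᵇ 3 in q3 | typePresentᵇ 4 in q4
  ... | true | true | _ | _ | _ = ⊥-elim (incompatible 0 1 (λ ()) refl q0 q1)
  ... | true | _ | _ | true | _ = ⊥-elim (incompatible 0 3 (λ ()) refl q0 q3)
  ... | _ | true | true | _ | _ = ⊥-elim (incompatible 1 2 (λ ()) refl q1 q2)
  ... | _ | _ | true | true | _ = ⊥-elim (incompatible 2 3 (λ ()) refl q2 q3)
  ... | false | false | false | false | false = ≅E1 (iso-from-certificate E1 iso-none (presence-agrees q0 q1 q2 q3 q4))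
  ... | false | false | false | false | true = ≅E3 (iso-from-certificate E3 iso-B (presence-agrees q0 q1 q2 q3 q4))
  ... | false | false | false | true | false = ≅E2 (iso-from-certificate E2 iso-A′ (presence-agrees q0 q1 q2 q3 q4))
  ... | false | false | false | true | true = ≅E5 (iso-from-certificate E5 iso-A′B (presence-agrees q0 q1 q2 q3 q4))
  ... | false | false | true | false | false = ≅E4 (iso-from-certificate E4 iso-C (presence-agrees q0 q1 q2 q3 q4))
  ... | false | false | true | false | true = ≅E7 (iso-from-certificate E7 iso-CB (presence-agrees q0 q1 q2 q3 q4))
  ... | false | true | false | false | false = ≅E4 (iso-from-certificate E4 iso-C′ (presence-agrees q0 q1 q2 q3 q4))
  ... | false | true | false | false | true = ≅E7 (iso-from-certificate E7 iso-C′B (presence-agrees q0 q1 q2 q3 q4))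
  ... | false | true | false | true | false = ≅E6 (iso-from-certificate E6 iso-C′A′ (presence-agrees q0 q1 q2 q3 q4))
  ... | false | true | false | true | true = ≅E8 (iso-from-certificate E8 iso-C′A′B (presence-agrees q0 q1 q2 q3 q4))
  ... | true | false | false | false | false = ≅E2 (iso-from-certificate E2 iso-A (presence-agrees q0 q1 q2 q3 q4))
  ... | true | false | false | false | true = ≅E5 (iso-from-certificate E5 iso-AB (presence-agrees q0 q1 q2 q3 q4))
  ... | true | false | true | false | false = ≅E6 (iso-from-certificate E6 iso-AC (presence-agrees q0 q1 q2 q3 q4))
  ... | true | false | true | false | true = ≅E8 (iso-from-certificate E8 iso-ACB (presence-agrees q0 q1 q2 q3 q4))

-- Around an induced C₇

adjC7 : ℕ → ℕ → Bool
adjC7 i j = adj (C 7) (toFin 6 i) (toFin 6 j)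

c5ThroughNeighbourOfC7 : List Bool → List ℕ
c5ThroughNeighbourOfC7 bs =
  if bs ≡ᴮ (true ∷ true ∷ false ∷ true ∷ true ∷ false ∷ false ∷ []) then (0 ∷ 6 ∷ 5 ∷ 4 ∷ 7 ∷ []) else
  if bs ≡ᴮ (true ∷ true ∷ false ∷ false ∷ true ∷ true ∷ false ∷ []) then (1 ∷ 2 ∷ 3 ∷ 4 ∷ 7 ∷ []) else
  if bs ≡ᴮ (false ∷ true ∷ true ∷ false ∷ true ∷ true ∷ false ∷ []) then (0 ∷ 1 ∷ 7 ∷ 5 ∷ 6 ∷ []) else
  if bs ≡ᴮ (true ∷ false ∷ true ∷ true ∷ false ∷ false ∷ true ∷ []) then (3 ∷ 4 ∷ 5 ∷ 6 ∷ 7 ∷ []) else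
  if bs ≡ᴮ (true ∷ false ∷ false ∷ true ∷ true ∷ false ∷ true ∷ []) then (0 ∷ 1 ∷ 2 ∷ 3 ∷ 7 ∷ []) else
  if bs ≡ᴮ (false ∷ true ∷ true ∷ false ∷ false ∷ true ∷ true ∷ []) then (2 ∷ 3 ∷ 4 ∷ 5 ∷ 7 ∷ []) else
  if bs ≡ᴮ (false ∷ false ∷ true ∷ true ∷ false ∷ true ∷ true ∷ []) then (0 ∷ 1 ∷ 2 ∷ 7 ∷ 6 ∷ []) else
  []

c5Index : List Bool → Fin 5 → ℕ
c5Index bs a = lookupOr 0 (c5ThroughNeighbourOfC7 bs) (toℕ a)

neighbourOfC7ᵇ : List Bool → Bool
neighbourOfC7ᵇ bs =
  not (admissible 7 adjC7 (bs ∷ []) noEdges (isNew 7)) ∨ emptyOnᵇ 7 bs ∨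
  matchesᵇ 8 (entry (memoise 8 (extendedTable 7 adjC7 (bs ∷ []) noEdges))) (C 5) (c5Index bs)

opaque
  unfolding admissible

  neighbour-of-C7-spans-C5 : allBitListsᵇ 7 neighbourOfC7ᵇ ≡ true
  neighbour-of-C7-spans-C5 = refl

independentPairInC7ᵇ : ℕ → ℕ → Bool
independentPairInC7ᵇ a b = not (a ≡ᵇ b) ∧ not (adjC7 a b)

independentInC7ᵇ : List ℕ → Bool
independentInC7ᵇ = pairwiseᵇ independentPairInC7ᵇ

notIndependentInC7ᵇ : ℕ → ℕ → ℕ → ℕ → Bool
notIndependentInC7ᵇ a b c d = not (independentInC7ᵇ (a ∷ b ∷ c ∷ d ∷ []))

C7-no-independent-quadruple :
  allBelowᵇ 7 (λ a → allBelowᵇ 7 (λ b → allBelowᵇ 7 (λ c → allBelowᵇ 7 (notIndependentInC7ᵇ a b c)))) ≡ true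
C7-no-independent-quadruple = refl

module C7Analysis {G : Graph} (connected : Connected G)
  (clawFree : ¬ ContainsInduced G claw) (twoK1∪K3Free : ¬ ContainsInduced G twoK1∪K3)
  (s : Fin 4 → V G) (s-injective : Injective _≡_ _≡_ s) (s-independent : ∀ i j → adj G (s i) (s j) ≡ false)
  (c : InducedEmbedding (C 7) G) where

  cycle : ℕ → V G
  cycle i = f c (toFin 6 i)

  coreC7 : Core G
  coreC7 = record { coreSize = 7 ; coreAdj = adjC7 ; coreVertex = cycle
                  ; coreAdj-agrees = λ i j → ≡.sym (adjPre c (toFin 6 i) (toFin 6 j)) }

  private
    not-all-inside : (∀ i → InCore coreC7 (s i)) → ⊥
    not-all-inside inside = true≢false (trans (≡.sym independent) (not-true not-independent))
      where
      index : Fin 4 → ℕ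
      index i = proj₁ (inside i)
      index< : ∀ i → (index i <ᵇ 7) ≡ true
      index< i = proj₁ (proj₂ (inside i))
      at-index : ∀ i → cycle (index i) ≡ s i
      at-index i = proj₂ (proj₂ (inside i))
      x₀ x₁ x₂ x₃ : ℕ
      x₀ = index 0F
      x₁ = index 1F
      x₂ = index 2F
      x₃ = index 3F
      not-independent : notIndependentInC7ᵇ x₀ x₁ x₂ x₃ ≡ true
      not-independent =
        allBelowᵇ²-sound 7 7 (notIndependentInC7ᵇ x₀ x₁)
          (allBelowᵇ²-sound 7 7 (λ a b → allBelowᵇ 7 (λ c → allBelowᵇ 7 (notIndependentInC7ᵇ a b c)))
                            C7-no-independent-quadruple x₀ x₁ (index< 0F) (index< 1F))
          x₂ x₃ (index< 2F) (index< 3F)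
      independent-pair : ∀ {i j} → i ≢ j → independentPairInC7ᵇ (index i) (index j) ≡ true
      independent-pair {i} {j} i≢j =
        ∧-intro (not-false (≢⇒≡ᵇ-false (index i) (index j) λ eq →
                             i≢j (s-injective (trans (≡.sym (at-index i)) (trans (cong cycle eq) (at-index j))))))
                (not-false (trans (coreAdj-agrees coreC7 (index i) (index j))
                                  (trans (cong₂ (adj G) (at-index i) (at-index j)) (s-independent i j))))
      independent : independentInC7ᵇ (map index (allFin 4)) ≡ true
      independent =
        pairwiseᵇ-complete independentPairInC7ᵇ (AllPairs.map⁺ {f = index} (AllPairs.tabulate⁺ {f = id} independent-pair))

    some-outside : Σ (Fin 4) λ i → OutsideCore coreC7 (s i)
    some-outside with inside-or-outside coreC7 s
    ... | inj₁ inside = ⊥-elim (not-all-inside inside)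
    ... | inj₂ outside = outside

  spans-C5 : InducedEmbedding (C 5) G
  spans-C5 with crossing-edge G (λ v → locate coreC7 v) (λ (h , h< , eq) outside → outside h h< eq)
                              (connected (s (proj₁ some-outside)) (cycle 0)) (proj₂ some-outside) (0 , refl , refl)
  ... | u , _ , uh , u-outside , (h , h< , refl) =
    embedding-of-match (Single.realisation coreC7 u u-outside) (C 5) (c5Index (profile coreC7 u)) spans twinFree-C5
    where
    nonempty : emptyOnᵇ 7 (profile coreC7 u) ≡ false
    nonempty rewrite anyBelowᵇ-complete 7 (lookupOr false (profile coreC7 u)) h h< (trans (profile-at coreC7 u h h<) uh) = refl
    -- Stated with map, as in the realisation, so that the two types agree without normalising the table.
    spans : matchesᵇ 8 (entry (memoise 8 (extendedTable 7 adjC7 (map (profile coreC7) (u ∷ [])) noEdges))) (C 5)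
                     (c5Index (profile coreC7 u)) ≡ true
    spans = ∨-resolveˡ (implies-true (allBitListsᵇ-sound 7 neighbourOfC7ᵇ neighbour-of-C7-spans-C5 (profile coreC7 u)
                                                         (length-profile coreC7 u))
                                     (Single.admissible-realised coreC7 u u-outside clawFree twoK1∪K3Free (isNew 7)))
                       nonempty

lemma2p3 : (G : Graph) → Connected G
    → ¬ ContainsInduced G claw → ¬ ContainsInduced G twoK1∪K3
    → IndependenceAtLeast 4 G
    → ¬ Iso G E1 → ¬ Iso G E2 → ¬ Iso G E3 → ¬ Iso G E4
    → ¬ Iso G E5 → ¬ Iso G E6 → ¬ Iso G E7 → ¬ Iso G E8
    → ¬ ContainsInduced G (C 5) × ¬ ContainsInduced G (C 7)
lemma2p3 G connected clawFree twoK1∪K3Free (s , s-injective , s-independent) ¬E1 ¬E2 ¬E3 ¬E4 ¬E5 ¬E6 ¬E7 ¬E8 =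
  no-C5 , no-C5 ∘ AtC7.spans-C5
  where
  module AtC5 = C5Analysis connected clawFree twoK1∪K3Free s s-injective s-independent
  module AtE1 = E1Analysis connected clawFree twoK1∪K3Free s s-injective s-independent
  module AtC7 = C7Analysis connected clawFree twoK1∪K3Free s s-injective s-independent

  not-some-E : IsomorphicToSomeE G → ⊥
  not-some-E (≅E1 iso) = ¬E1 iso
  not-some-E (≅E2 iso) = ¬E2 iso
  not-some-E (≅E3 iso) = ¬E3 iso
  not-some-E (≅E4 iso) = ¬E4 iso
  not-some-E (≅E5 iso) = ¬E5 iso
  not-some-E (≅E6 iso) = ¬E6 iso
  not-some-E (≅E7 iso) = ¬E7 iso
  not-some-E (≅E8 iso) = ¬E8 iso

  no-C5 : ¬ ContainsInduced G (C 5)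
  no-C5 = not-some-E ∘ AtE1.isomorphic-to-some-E ∘ AtC5.spans-E1
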